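{- Let $\mathbf H$ be a connected Hopf monoid linearized in the basis $\mathbf h$, $I$ a finite set, $\alpha,\beta\in\mathbf l[I]$, $x,y\in\mathbf h[I]$ with $\mathcal C_{\alpha,x}^{\beta,y}\neq\emptyset$ and minimal element $\Lambda=(\Lambda_1,\dots,\Lambda_m)$, and let $G=G_{\alpha,x}^{\beta,y}$ be the graph on $[m]$ defined below. If $G$ is disconnected, i.e. there is $1\le r<m$ such that no edge $(a,b)$ of $G$ has $a\in\{1,\dots,r\}$ and $b\in\{r+1,\dots,m\}$, then $c_{\alpha,x}^{\beta,y}=\sum_{A\in\mathcal C_{\alpha,x}^{\beta,y}}(-1)^{\ell(A)}=0$.
   Context: Work over a field of characteristic $0$. A connected Hopf monoid in vector species $\mathbf H$ has products $\mu_{A_1,A_2}$ and coproducts $\Delta_{A_1,A_2}$ for ordered decompositions $I=A_1\sqcup A_2$, satisfying associativity, coassociativity and compatibility axioms; it is linearized in the basis $\mathbf h$ if products send basis pairs to basis elements and coproducts send basis elements to $0$ or to a tensor of basis elements. A set composition $A=(A_1,\dots,A_k)\models I$ is a sequence of nonempty disjoint subsets with union $I$, $\ell(A)=k$; $\mu_A,\Delta_A$ are iterated product/coproduct. $A\le B$ if every part of $B$ is a union of consecutive parts of $A$. For a linear order $\alpha$ on $I$, $\alpha_A=\alpha|_{A_1}\cdots\alpha|_{A_k}$; for $x\in\mathbf h[I]$ with $\Delta_A(x)\ne0$, $x_A=\mu_A\Delta_A(x)$. $\mathcal C_{\alpha,x}^{\beta,y}=\{A\models I:\Delta_A(x)\neq0,\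 \alpha_A=\beta,\ x_A=y\}$; when nonempty it has a unique minimal element $\Lambda$ under refinement. For $1\le a<b\le m$ let $B_{ab}=(\Lambda_1,\dots,\Lambda_{a-1},\Lambda_a\cup\dots\cup\Lambda_b,\Lambda_{b+1},\dots,\Lambda_m)$. The graph $G=G_{\alpha,x}^{\beta,y}$ on $[m]$ has an edge $(a,b)$ iff $1\le a<b\le m$, $B_{ab}\notin\mathcal C_{\alpha,x}^{\beta,y}$, and for every $a<r<b$ both $B_{ar},B_{rb}\in\mathcal C_{\alpha,x}^{\beta,y}$. -}

module Defs where

open import Data.Nat using (ℕ; zero; suc; _≤_; _<_; _∸_)
open import Data.Integer using (ℤ; -_; _+_) renaming (+_ to pos)
open import Data.Fin using (Fin)
open import Data.Fin.Subset using (Subset; ⊥; _∪_; _∩_; _─_; _⊆_; ⋃; Nonempty) renaming (_∈_ to _∈ₛ_)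
open import Data.Fin.Subset.Properties using (_∈?_)
open import Data.List using (List; []; _∷_; length; filter; concatMap; take; drop; _++_; foldr; map)
open import Data.List.Relation.Unary.All using (All)
open import Data.List.Relation.Unary.AllPairs using (AllPairs)
open import Data.List.Relation.Unary.Unique.Propositional using (Unique)
open import Data.List.Membership.Propositional using () renaming (_∈_ to _∈ₗ_)
open import Data.Maybe using (Maybe; just; nothing; _>>=_)
open import Data.Product using (_×_; _,_; ∃; Σ)
open import Function.Bundles using (_⇔_)
open import Relation.Binary.PropositionalEquality using (_≡_)
open import Relation.Nullary using (¬_)

Disjoint : ∀ {n} → Subset n → Subset n → Set
Disjoint S T = S ∩ T ≡ ⊥

coassocL : ∀ {E : Set} → (E → Maybe (E × E)) → (E → Maybe (E × E)) → E → Maybe (E × E × E)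
coassocL ΔT ΔS x = ΔT x >>= λ { (u , w) → ΔS u >>= λ { (a , b) → just (a , b , w) } }

coassocR : ∀ {E : Set} → (E → Maybe (E × E)) → (E → Maybe (E × E)) → E → Maybe (E × E × E)
coassocR ΔS ΔTS x = ΔS x >>= λ { (a , v) → ΔTS v >>= λ { (b , w) → just (a , b , w) } }

compatR : ∀ {E : Set} → (E → E → E) → Maybe (E × E) → Maybe (E × E) → Maybe (E × E)
compatR μ mx my = mx >>= λ { (x₁ , x₂) → my >>= λ { (y₁ , y₂) → just (μ x₁ y₁ , μ x₂ y₂) } }

-- A connected Hopf monoid linearized in a basis h, on the species restricted to
-- the subsets of the ground set Fin n.  E is the disjoint union of all basis
-- sets h[S] (S ⊆ Fin n), supp e = S means e ∈ h[S].
-- μ x y is the basis element μ_{S,T}(x ⊗ y) (only meaningful for disjoint supports);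
-- Δ S x = nothing means Δ_{S, supp x ─ S}(x) = 0, and Δ S x = just (a , b)
-- means Δ_{S, supp x ─ S}(x) = a ⊗ b (only meaningful for S ⊆ supp x).
record LinHopf (n : ℕ) : Set₁ where
  field
    E    : Set
    supp : E → Subset n
    μ    : E → E → E
    Δ    : Subset n → E → Maybe (E × E)
    one  : E
    supp-one  : supp one ≡ ⊥
    connected : ∀ e → supp e ≡ ⊥ → e ≡ one
    supp-μ  : ∀ x y → Disjoint (supp x) (supp y) → supp (μ x y) ≡ supp x ∪ supp y
    μ-unitˡ : ∀ x → μ one x ≡ x
    μ-unitʳ : ∀ x → μ x one ≡ x
    μ-assoc : ∀ x y z → Disjoint (supp x) (supp y) → Disjoint (supp x) (supp z) →
              Disjoint (supp y) (supp z) → μ (μ x y) z ≡ μ x (μ y z)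
    supp-Δ    : ∀ S x a b → S ⊆ supp x → Δ S x ≡ just (a , b) →
                supp a ≡ S × supp b ≡ supp x ─ S
    Δ-counitˡ : ∀ x → Δ ⊥ x ≡ just (one , x)
    Δ-counitʳ : ∀ x → Δ (supp x) x ≡ just (x , one)
    Δ-coassoc : ∀ S T x → S ⊆ T → T ⊆ supp x →
                coassocL (Δ T) (Δ S) x ≡ coassocR (Δ S) (Δ (T ─ S)) x
    compat : ∀ S x y → Disjoint (supp x) (supp y) → S ⊆ supp x ∪ supp y →
             Δ S (μ x y) ≡ compatR μ (Δ (S ∩ supp x) x) (Δ (S ∩ supp y) y)

IsSetComp : ∀ {n} → Subset n → List (Subset n) → Set
IsSetComp I A = All Nonempty A × AllPairs Disjoint A × ⋃ A ≡ I

IsLinOrder : ∀ {n} → Subset n → List (Fin n) → Set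
IsLinOrder I α = Unique α × (∀ i → (i ∈ₗ α) ⇔ (i ∈ₛ I))

restrictOrd : ∀ {n} → List (Fin n) → List (Subset n) → List (Fin n)
restrictOrd α A = concatMap (λ S → filter (λ i → i ∈? S) α) A

-- A ≤ B: every part of B is a union of consecutive parts of A
Refines : ∀ {n} → List (Subset n) → List (Subset n) → Set
Refines {n} A B = Σ (List (List (Subset n))) λ Gs →
  All (λ G → ¬ (G ≡ [])) Gs × foldr _++_ [] Gs ≡ A × map ⋃ Gs ≡ B

module _ {n : ℕ} (H : LinHopf n) where
  open LinHopf H

  -- Δ_A for a sequence of parts: nothing = 0, just (a₁ ∷ … ∷ a_k) = a₁ ⊗ … ⊗ a_k
  Δs : List (Subset n) → E → Maybe (List E)
  Δs []      x = just []
  Δs (S ∷ A) x = Δ S x >>= λ { (a , r) → Δs A r >>= λ as → just (a ∷ as) }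

  μs : List E → E
  μs []       = one
  μs (a ∷ as) = μ a (μs as)


  -- A ∈ C_{α,x}^{β,y}: A ⊨ I, Δ_A(x) ≠ 0, α_A = β, x_A = y
  InC : Subset n → List (Fin n) → E → List (Fin n) → E → List (Subset n) → Set
  InC I α x β y A = IsSetComp I A ×
    (Σ (List E) λ as → Δs A x ≡ just as × restrictOrd α A ≡ β × μs as ≡ y)

-- B_{ab}: merge the parts a,…,b (1-based) of Λ into one part
mergeParts : ∀ {n} → ℕ → ℕ → List (Subset n) → List (Subset n)
mergeParts a b Λ = take (a ∸ 1) Λ ++ (⋃ (drop (a ∸ 1) (take b Λ)) ∷ drop b Λ)

-- (a , b) is an edge of G_{α,x}^{β,y} (C given as a predicate, Λ its minimum, m = ℓ(Λ))
IsEdge : ∀ {n} → (List (Subset n) → Set) → List (Subset n) → ℕ → ℕ → Set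
IsEdge C Λ a b = 1 ≤ a × a < b × b ≤ length Λ × ¬ C (mergeParts a b Λ) ×
  (∀ r → a < r → r < b → C (mergeParts a r Λ) × C (mergeParts r b Λ))

sgn : ℕ → ℤ
sgn zero    = pos 1
sgn (suc k) = - sgn k

signedSum : ∀ {n} → List (List (Subset n)) → ℤ
signedSum L = foldr (λ A s → sgn (length A) + s) (pos 0) L

module Submission where

-- Every A ∈ C is coarser than the minimum Λ, so A is the list of unions of the blocks of a
-- grouping of the parts of Λ into consecutive nonempty blocks. Since Δ_A(x) is a coarsening of
-- Δ_Λ(x), membership A ∈ C is local: it holds iff merging each block alone into one part of Λ
-- gives an element of C, and the intervals [a, b] with B_ab ∈ C are closed under taking
-- subintervals. When no edge of G crosses the cut between r and r + 1, two such intervals meeting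
-- at the cut merge into one, since a shortest crossing interval outside C would be such an edge.
-- Hence toggling the cut after the r-th part of Λ (splitting the block that contains it, or merging
-- the two blocks it separates) is a fixed-point-free involution of C changing ℓ(A) by ±1, and the
-- signed sum vanishes.

open import Data.Nat
  using (ℕ; zero; suc; _≤_; _<_; _∸_; _+_; z≤n; s≤s; _≤′_; ≤′-refl; ≤′-step; _≤‴_; ≤‴-refl; ≤‴-step)
import Data.Nat.Properties as ℕ
open import Data.Integer using (ℤ; -_) renaming (_+_ to _+ℤ_; +_ to pos)
import Data.Integer.Properties as ℤ
open import Data.Integer.Tactic.RingSolver using (solve-∀)
open import Data.Bool using (true; false)
import Data.Bool as Bool
open import Data.Vec using ([]; _∷_)
import Data.Vec.Properties as Vec
open import Data.Fin using (Fin)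
open import Data.Fin.Subset using (Subset; ⊥; _∪_; _∩_; _─_; _⊆_; ⋃; Nonempty)
  renaming (_∈_ to _∈ₛ_; _∉_ to _∉ₛ_)
open import Data.Fin.Subset.Properties
open import Data.List using (List; []; _∷_; _++_; _∷ʳ_; length; map; concat; foldr; filter; take; drop; initLast; _∷ʳ′_)
import Data.List.Properties as List
open import Data.List.Relation.Unary.All using (All; []; _∷_)
import Data.List.Relation.Unary.All as All
import Data.List.Relation.Unary.All.Properties as Allₚ
open import Data.List.Relation.Unary.AllPairs using (AllPairs; []; _∷_)
import Data.List.Relation.Unary.AllPairs.Properties as AllPairsₚ
open import Data.List.Relation.Unary.Any using (here; there)
open import Data.List.Relation.Unary.Unique.Propositional using (Unique)
open import Data.List.Relation.Binary.Pointwise as Pointwise using (Pointwise; []; _∷_)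
open import Data.List.Membership.Propositional using (_∈_; _∉_)
open import Data.List.Membership.Propositional.Properties using (∈-++⁺ˡ; ∈-++⁺ʳ; ∈-++⁻; ∈-∃++)
open import Data.Maybe using (Maybe; just)
open import Data.Product using (_×_; _,_; proj₁; proj₂; Σ)
open import Data.Sum using (_⊎_; inj₁; inj₂)
open import Data.Unit using (⊤; tt)
open import Data.Empty using () renaming (⊥ to ⊥₀; ⊥-elim to ⊥₀-elim)
open import Function using (_∘_)
open import Function.Bundles using (_⇔_; mk⇔; Equivalence)
open import Relation.Binary.PropositionalEquality
open import Relation.Nullary using (¬_; Dec; yes; no)
import Relation.Nullary.Decidable as Dec
open import Defs

private variable k : ℕ

-- Disjoint subsets and groupings of lists

∪≡⊥⇒ˡ≡⊥ : {p q : Subset k} → p ∪ q ≡ ⊥ → p ≡ ⊥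
∪≡⊥⇒ˡ≡⊥ {p = p} {q} e = trans (sym (∩-abs-∪ p q)) (trans (cong (p ∩_) e) (∩-zeroʳ p))

Disjoint-sym : {S T : Subset k} → Disjoint S T → Disjoint T S
Disjoint-sym {S = S} {T} d = trans (∩-comm T S) d

Disjoint-⊥ : (S : Subset k) → Disjoint S ⊥
Disjoint-⊥ = ∩-zeroʳ

Disjoint-∪⁻ : {S T U : Subset k} → Disjoint S (T ∪ U) → Disjoint S T × Disjoint S U
Disjoint-∪⁻ {S = S} {T} {U} d = ∪≡⊥⇒ˡ≡⊥ d′ , ∪≡⊥⇒ˡ≡⊥ (trans (∪-comm (S ∩ U) (S ∩ T)) d′)
  where
  d′ : (S ∩ T) ∪ (S ∩ U) ≡ ⊥
  d′ = trans (sym (∩-distribˡ-∪ S T U)) d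

Disjoint-∪⁺ : {S T U : Subset k} → Disjoint S T → Disjoint S U → Disjoint S (T ∪ U)
Disjoint-∪⁺ {S = S} {T} {U} d₁ d₂ =
  trans (∩-distribˡ-∪ S T U) (trans (cong₂ _∪_ d₁ d₂) (∪-identityˡ ⊥))

Disjoint⇒∉ : {i : Fin k} {S T : Subset k} → Disjoint S T → i ∈ₛ S → i ∉ₛ T
Disjoint⇒∉ d i∈S i∈T = ∉⊥ (subst (_ ∈ₛ_) d (x∈p∩q⁺ (i∈S , i∈T)))

∪-─-cancelˡ : {S T : Subset k} → Disjoint S T → (S ∪ T) ─ S ≡ T
∪-─-cancelˡ {S = []}        {[]}        d = refl
∪-─-cancelˡ {S = true ∷ S}  {false ∷ T} d = cong (false ∷_) (∪-─-cancelˡ (Vec.∷-injectiveʳ d))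
∪-─-cancelˡ {S = true ∷ S}  {true ∷ T}  ()
∪-─-cancelˡ {S = false ∷ S} {t ∷ T}     d = cong (t ∷_) (∪-─-cancelˡ (Vec.∷-injectiveʳ d))

∪-cancelˡ : {S T U : Subset k} → Disjoint S T → Disjoint S U → S ∪ T ≡ S ∪ U → T ≡ U
∪-cancelˡ {S = S} dT dU e = trans (sym (∪-─-cancelˡ dT)) (trans (cong (_─ S) e) (∪-─-cancelˡ dU))

module _ {a r} {A : Set a} {R : A → A → Set r} where

  AllPairs-++⁻ : (xs : List A) {ys : List A} → AllPairs R (xs ++ ys) →
    AllPairs R xs × AllPairs R ys × All (λ x → All (R x) ys) xs
  AllPairs-++⁻ []       p          = [] , p , []
  AllPairs-++⁻ (x ∷ xs) (px ∷ pxs) with AllPairs-++⁻ xs pxs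
  ... | p₁ , p₂ , p₁₂ = Allₚ.++⁻ˡ xs px ∷ p₁ , p₂ , Allₚ.++⁻ʳ xs px ∷ p₁₂

  AllPairs-++⁻ˡ : (xs : List A) {ys : List A} → AllPairs R (xs ++ ys) → AllPairs R xs
  AllPairs-++⁻ˡ xs p = proj₁ (AllPairs-++⁻ xs p)

  AllPairs-++⁻ʳ : (xs : List A) {ys : List A} → AllPairs R (xs ++ ys) → AllPairs R ys
  AllPairs-++⁻ʳ xs p = proj₁ (proj₂ (AllPairs-++⁻ xs p))

⋃-++ : (F G : List (Subset k)) → ⋃ (F ++ G) ≡ ⋃ F ∪ ⋃ G
⋃-++ []      G = sym (∪-identityˡ _)
⋃-++ (S ∷ F) G = trans (cong (S ∪_) (⋃-++ F G)) (sym (∪-assoc S (⋃ F) (⋃ G)))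

⋃-map⋃ : (Ks : List (List (Subset k))) → ⋃ (map ⋃ Ks) ≡ ⋃ (concat Ks)
⋃-map⋃ []       = refl
⋃-map⋃ (g ∷ Ks) = trans (cong (⋃ g ∪_) (⋃-map⋃ Ks)) (sym (⋃-++ g (concat Ks)))

Disjoint-⋃⁺ : {S : Subset k} {F : List (Subset k)} → All (Disjoint S) F → Disjoint S (⋃ F)
Disjoint-⋃⁺ {S = S} []  = Disjoint-⊥ S
Disjoint-⋃⁺ (d ∷ ds)    = Disjoint-∪⁺ d (Disjoint-⋃⁺ ds)

Disjoint-⋃⁻ : {S : Subset k} {F : List (Subset k)} → Disjoint S (⋃ F) → All (Disjoint S) F
Disjoint-⋃⁻ {F = []}    d = []
Disjoint-⋃⁻ {F = T ∷ F} d = proj₁ (Disjoint-∪⁻ d) ∷ Disjoint-⋃⁻ (proj₂ (Disjoint-∪⁻ d))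

Disjoint-⋃-++ : (g : List (Subset k)) {R : List (Subset k)} →
  AllPairs Disjoint (g ++ R) → Disjoint (⋃ g) (⋃ R)
Disjoint-⋃-++ g {R} p = Disjoint-sym (Disjoint-⋃⁺ (All.map (λ d → Disjoint-sym (Disjoint-⋃⁺ d)) g∣R))
  where
  g∣R : All (λ S → All (Disjoint S) R) g
  g∣R = proj₂ (proj₂ (AllPairs-++⁻ g p))

AllPairs-Disjoint-map⋃ : (Ks : List (List (Subset k))) →
  AllPairs Disjoint (concat Ks) → AllPairs Disjoint (map ⋃ Ks)
AllPairs-Disjoint-map⋃ []       p = []
AllPairs-Disjoint-map⋃ (g ∷ Ks) p =
  Disjoint-⋃⁻ (subst (Disjoint (⋃ g)) (sym (⋃-map⋃ Ks)) (Disjoint-⋃-++ g p))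
    ∷ AllPairs-Disjoint-map⋃ Ks (AllPairs-++⁻ʳ g p)

module _ {a} {A : Set a} where

  take-length-++ : (P R : List A) → take (length P) (P ++ R) ≡ P
  take-length-++ []      R = refl
  take-length-++ (s ∷ P) R = cong (s ∷_) (take-length-++ P R)

  drop-length-++ : (P R : List A) → drop (length P) (P ++ R) ≡ R
  drop-length-++ []      R = refl
  drop-length-++ (s ∷ P) R = drop-length-++ P R

  length-take-≤ : ∀ j (xs : List A) → j ≤ length xs → length (take j xs) ≡ j
  length-take-≤ j xs j≤ = trans (List.length-take j xs) (ℕ.m≤n⇒m⊓n≡m j≤)

  nonempty⇒1≤length : (xs : List A) → ¬ xs ≡ [] → 1 ≤ length xs
  nonempty⇒1≤length []      ne = ⊥₀-elim (ne refl)
  nonempty⇒1≤length (_ ∷ _) ne = s≤s z≤n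

++-injective-length : ∀ {a} {A : Set a} (u u′ : List A) {v v′ : List A} → length u ≡ length u′ →
  u ++ v ≡ u′ ++ v′ → u ≡ u′ × v ≡ v′
++-injective-length []      []        _   e = refl , e
++-injective-length (a ∷ u) (a′ ∷ u′) len e with refl , e′ ← List.∷-injective e
  with refl , v≡v′ ← ++-injective-length u u′ (ℕ.suc-injective len) e′ = refl , v≡v′

NonemptyBlocks : ∀ {a} {A : Set a} → List (List A) → Set a
NonemptyBlocks = All (λ g → ¬ g ≡ [])

⋃-prefix-unique : (g g′ R R′ : List (Subset k)) → g ++ R ≡ g′ ++ R′ → AllPairs Disjoint (g ++ R) →
  All Nonempty (g ++ R) → ⋃ g ≡ ⋃ g′ → g ≡ g′ × R ≡ R′
⋃-prefix-unique []      []        R R′ e    _ _ _ = refl , e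
⋃-prefix-unique []      (S ∷ g′) R R′ refl _ ((i , i∈S) ∷ _) u =
  ⊥₀-elim (∉⊥ (subst (i ∈ₛ_) (sym u) (p⊆p∪q (⋃ g′) i∈S)))
⋃-prefix-unique (S ∷ g) []        R R′ refl _ ((i , i∈S) ∷ _) u =
  ⊥₀-elim (∉⊥ (subst (i ∈ₛ_) u (p⊆p∪q (⋃ g) i∈S)))
⋃-prefix-unique (S ∷ g) (S′ ∷ g′) R R′ e (d ∷ ds) (_ ∷ nes) u with List.∷-injective e
... | refl , e′ with ⋃-prefix-unique g g′ R R′ e′ ds nes
                       (∪-cancelˡ (Disjoint-⋃⁺ (Allₚ.++⁻ˡ g d))
                                  (Disjoint-⋃⁺ (Allₚ.++⁻ˡ g′ (subst (All (Disjoint S)) e′ d))) u)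
... | refl , refl = refl , refl

map⋃-injective : (Gs Gs′ : List (List (Subset k))) → NonemptyBlocks Gs → NonemptyBlocks Gs′ →
  concat Gs ≡ concat Gs′ → AllPairs Disjoint (concat Gs) → All Nonempty (concat Gs) →
  map ⋃ Gs ≡ map ⋃ Gs′ → Gs ≡ Gs′
map⋃-injective []       []          _          _          _ _  _   _ = refl
map⋃-injective []       (g ∷ Gs′) _          (ng ∷ _)   e _  _   _ = ⊥₀-elim (ng (List.++-conicalˡ g _ (sym e)))
map⋃-injective (g ∷ Gs) []          (ng ∷ _)   _          e _  _   _ = ⊥₀-elim (ng (List.++-conicalˡ g _ e))
map⋃-injective (g ∷ Gs) (g′ ∷ Gs′) (_ ∷ nGs) (_ ∷ nGs′) e ds nes e⋃ with List.∷-injective e⋃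
... | u , e⋃′ with ⋃-prefix-unique g g′ (concat Gs) (concat Gs′) e ds nes u
... | refl , e′ = cong (g ∷_) (map⋃-injective Gs Gs′ nGs nGs′ e′ (AllPairs-++⁻ʳ g ds) (Allₚ.++⁻ʳ g nes) e⋃′)

-- Toggling a grouping at a cut

module Toggle {X : Set} where
  open import Relation.Binary.Definitions using (tri<; tri≈; tri>)

  mergeHead : List X → List (List X) → List (List X)
  mergeHead g []       = g ∷ []
  mergeHead g (h ∷ Gs) = (g ++ h) ∷ Gs

  -- Cut the flattened list after its j-th element: split the block the cut falls inside,
  -- or merge the two blocks the cut separates.
  toggle : ℕ → List (List X) → List (List X)
  toggle j []       = []
  toggle j (g ∷ Gs) with ℕ.<-cmp j (length g)
  ... | tri< _ _ _ = take j g ∷ drop j g ∷ Gs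
  ... | tri≈ _ _ _ = mergeHead g Gs
  ... | tri> _ _ _ = g ∷ toggle (j ∸ length g) Gs

  concat-toggle : ∀ j Gs → concat (toggle j Gs) ≡ concat Gs
  concat-toggle j []       = refl
  concat-toggle j (g ∷ Gs) with ℕ.<-cmp j (length g)
  ... | tri< _ _ _ = trans (sym (List.++-assoc (take j g) (drop j g) (concat Gs)))
                           (cong (_++ concat Gs) (List.take++drop≡id j g))
  ... | tri> _ _ _ = cong (g ++_) (concat-toggle (j ∸ length g) Gs)
  concat-toggle j (g ∷ [])     | tri≈ _ _ _ = refl
  concat-toggle j (g ∷ h ∷ Gs) | tri≈ _ _ _ = List.++-assoc g h (concat Gs)

  ∸-length-< : ∀ {j} (g : List X) Gs → length g < j → j < length (concat (g ∷ Gs)) →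
    j ∸ length g < length (concat Gs)
  ∸-length-< {j} g Gs g<j j< = ℕ.+-cancelˡ-< (length g) _ _
    (subst₂ _<_ (sym (ℕ.m+[n∸m]≡n (ℕ.<⇒≤ g<j))) (List.length-++ g) j<)

  ≮length-last : ∀ {j} (g : List X) → j ≡ length g → ¬ j < length (concat (g ∷ []))
  ≮length-last g refl = ℕ.<-irrefl (sym (cong length (List.++-identityʳ g)))

  toggle-nonempty : ∀ j Gs → 1 ≤ j → j < length (concat Gs) →
    NonemptyBlocks Gs → NonemptyBlocks (toggle j Gs)
  toggle-nonempty j (g ∷ Gs) 1≤j j< (ng ∷ ns) with ℕ.<-cmp j (length g)
  ... | tri< j<g _ _ = take≢[] ∷ drop≢[] ∷ ns
    where
    take≢[] : ¬ take j g ≡ []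
    take≢[] e = ℕ.<⇒≱ 1≤j (ℕ.≤-reflexive (trans (sym (length-take-≤ j g (ℕ.<⇒≤ j<g))) (cong length e)))
    drop≢[] : ¬ drop j g ≡ []
    drop≢[] e = ℕ.<-irrefl (sym (ℕ.n≤0⇒n≡0 (ℕ.≤-reflexive (trans (sym (List.length-drop j g))
      (cong length e))))) (ℕ.m<n⇒0<n∸m j<g)
  ... | tri> _ _ g<j = ng ∷ toggle-nonempty (j ∸ length g) Gs (ℕ.m<n⇒0<n∸m g<j) (∸-length-< g Gs g<j j<) ns
  toggle-nonempty j (g ∷ [])     1≤j j< (ng ∷ ns)      | tri≈ _ _ _ = ng ∷ []
  toggle-nonempty j (g ∷ h ∷ Gs) 1≤j j< (ng ∷ nh ∷ ns) | tri≈ _ _ _ = (λ e → ng (List.++-conicalˡ g h e)) ∷ ns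

  length-<-++ : (g h : List X) → ¬ h ≡ [] → length g < length (g ++ h)
  length-<-++ g h nh = subst (length g <_) (sym (List.length-++ g)) (ℕ.m<m+n (length g) (nonempty⇒1≤length h nh))

  toggle-involutive : ∀ j Gs → 1 ≤ j → j < length (concat Gs) → NonemptyBlocks Gs →
    toggle j (toggle j Gs) ≡ Gs
  toggle-involutive j (g ∷ Gs) 1≤j j< (ng ∷ ns) with ℕ.<-cmp j (length g)
  ... | tri< j<g _ _ with ℕ.<-cmp j (length (take j g))
  ...   | tri< j<t _ _ = ⊥₀-elim (ℕ.<-irrefl (sym (length-take-≤ j g (ℕ.<⇒≤ j<g))) j<t)
  ...   | tri≈ _ _ _   = cong (_∷ Gs) (List.take++drop≡id j g)
  ...   | tri> _ _ t<j = ⊥₀-elim (ℕ.<-irrefl (length-take-≤ j g (ℕ.<⇒≤ j<g)) t<j)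
  toggle-involutive j (g ∷ Gs) 1≤j j< (ng ∷ ns) | tri> _ _ g<j with ℕ.<-cmp j (length g)
  ...   | tri< j<g _ _ = ⊥₀-elim (ℕ.<-asym j<g g<j)
  ...   | tri≈ _ j≡g _ = ⊥₀-elim (ℕ.<-irrefl (sym j≡g) g<j)
  ...   | tri> _ _ _   = cong (g ∷_) (toggle-involutive (j ∸ length g) Gs (ℕ.m<n⇒0<n∸m g<j) (∸-length-< g Gs g<j j<) ns)
  toggle-involutive j (g ∷ [])     1≤j j< (ng ∷ ns)      | tri≈ _ j≡g _ = ⊥₀-elim (≮length-last g j≡g j<)
  toggle-involutive j (g ∷ h ∷ Gs) 1≤j j< (ng ∷ nh ∷ ns) | tri≈ _ refl _
    with ℕ.<-cmp (length g) (length (g ++ h))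
  ... | tri< _ _ _    = cong₂ (λ u v → u ∷ v ∷ Gs) (take-length-++ g h) (drop-length-++ g h)
  ... | tri≈ _ g≡gh _ = ⊥₀-elim (ℕ.<-irrefl g≡gh (length-<-++ g h nh))
  ... | tri> _ _ gh<g = ⊥₀-elim (ℕ.<-asym (length-<-++ g h nh) gh<g)

  length-toggle : ∀ j Gs → j < length (concat Gs) →
    length (toggle j Gs) ≡ suc (length Gs) ⊎ suc (length (toggle j Gs)) ≡ length Gs
  length-toggle j (g ∷ Gs) j< with ℕ.<-cmp j (length g)
  ... | tri< _ _ _   = inj₁ refl
  ... | tri> _ _ g<j with length-toggle (j ∸ length g) Gs (∸-length-< g Gs g<j j<)
  ...   | inj₁ e = inj₁ (cong suc e)
  ...   | inj₂ e = inj₂ (cong suc e)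
  length-toggle j (g ∷ [])     j< | tri≈ _ j≡g _ = ⊥₀-elim (≮length-last g j≡g j<)
  length-toggle j (g ∷ h ∷ Gs) j< | tri≈ _ _ _   = inj₂ refl

-- Sign-reversing pairings

module SignReversingPairing {A : Set} (R : A → A → Set) (s : A → ℤ)
  (R-sym : ∀ {a b} → R a b → R b a)
  (R-functional : ∀ {a b c} → R a b → R a c → b ≡ c)
  (R-irreflexive : ∀ {a b} → R a b → ¬ a ≡ b)
  (R-flips-sign : ∀ {a b} → R a b → s b ≡ - s a) where

  Σs : List A → ℤ
  Σs = foldr (λ a t → s a +ℤ t) (pos 0)

  Σs-++ : ∀ L₁ L₂ → Σs (L₁ ++ L₂) ≡ Σs L₁ +ℤ Σs L₂
  Σs-++ []       L₂ = sym (ℤ.+-identityˡ _)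
  Σs-++ (a ∷ L₁) L₂ = trans (cong (s a +ℤ_) (Σs-++ L₁ L₂)) (sym (ℤ.+-assoc (s a) _ _))

  PairedWithin : List A → Set
  PairedWithin L = ∀ a → a ∈ L → Σ A λ b → b ∈ L × R a b

  private
    cancel : ∀ u v w → u +ℤ (v +ℤ (- u +ℤ w)) ≡ v +ℤ w
    cancel = solve-∀

    Unique-remove : (L₁ : List A) {b : A} {L₂ : List A} → Unique (L₁ ++ b ∷ L₂) → Unique (L₁ ++ L₂)
    Unique-remove L₁ u with AllPairs-++⁻ L₁ u
    ... | u₁ , _ ∷ u₂ , u₁₂ = AllPairsₚ.++⁺ u₁ u₂ (All.map (λ { (_ ∷ ps) → ps }) u₁₂)

    ∉-Unique-middle : (L₁ : List A) {b : A} {L₂ : List A} → Unique (L₁ ++ b ∷ L₂) → b ∉ L₁ ++ L₂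
    ∉-Unique-middle L₁ u with AllPairs-++⁻ L₁ u
    ... | _ , b≢L₂ ∷ _ , u₁₂ =
      Allₚ.All¬⇒¬Any (Allₚ.++⁺ (All.map (λ { (x≢b ∷ _) → ≢-sym x≢b }) u₁₂) b≢L₂)

    ∈-insert-middle : (L₁ : List A) {b c : A} {L₂ : List A} → c ∈ L₁ ++ L₂ → c ∈ L₁ ++ b ∷ L₂
    ∈-insert-middle L₁ c∈ with ∈-++⁻ L₁ c∈
    ... | inj₁ p = ∈-++⁺ˡ p
    ... | inj₂ p = ∈-++⁺ʳ L₁ (there p)

    ∈-remove-middle : (L₁ : List A) {b c : A} {L₂ : List A} → c ∈ L₁ ++ b ∷ L₂ → ¬ c ≡ b → c ∈ L₁ ++ L₂
    ∈-remove-middle L₁ c∈ c≢b with ∈-++⁻ L₁ c∈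
    ... | inj₁ p          = ∈-++⁺ˡ p
    ... | inj₂ (here c≡b) = ⊥₀-elim (c≢b c≡b)
    ... | inj₂ (there p)  = ∈-++⁺ʳ L₁ p

  Σs-cancels-bounded : ∀ bound L → length L ≤ bound → Unique L → PairedWithin L → Σs L ≡ pos 0
  Σs-cancels-bounded _           []      _         _          _      = refl
  Σs-cancels-bounded (suc bound) (a ∷ L) (s≤s L≤) (a≢L ∷ uL) paired with paired a (here refl)
  ... | b , here refl , Rab = ⊥₀-elim (R-irreflexive Rab refl)
  ... | b , there b∈L , Rab with ∈-∃++ b∈L
  ... | L₁ , L₂ , refl = begin
      s a +ℤ Σs (L₁ ++ b ∷ L₂)
        ≡⟨ cong (s a +ℤ_) (Σs-++ L₁ (b ∷ L₂)) ⟩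
      s a +ℤ (Σs L₁ +ℤ (s b +ℤ Σs L₂))
        ≡⟨ cong (λ t → s a +ℤ (Σs L₁ +ℤ (t +ℤ Σs L₂))) (R-flips-sign Rab) ⟩
      s a +ℤ (Σs L₁ +ℤ (- s a +ℤ Σs L₂))
        ≡⟨ cancel (s a) (Σs L₁) (Σs L₂) ⟩
      Σs L₁ +ℤ Σs L₂
        ≡⟨ Σs-++ L₁ L₂ ⟨
      Σs (L₁ ++ L₂)
        ≡⟨ Σs-cancels-bounded bound (L₁ ++ L₂) L₁₂≤ (Unique-remove L₁ uL) paired′ ⟩
      pos 0 ∎
    where
    open ≡-Reasoning
    L₁₂≤ : length (L₁ ++ L₂) ≤ bound
    L₁₂≤ = ℕ.≤-trans (ℕ.≤-reflexive (List.length-++ L₁))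
             (ℕ.≤-trans (ℕ.+-monoʳ-≤ (length L₁) (ℕ.n≤1+n (length L₂)))
               (ℕ.≤-trans (ℕ.≤-reflexive (sym (List.length-++ L₁))) L≤))
    -- Removing a and its partner b leaves the rest paired, as R is symmetric and functional.
    paired′ : PairedWithin (L₁ ++ L₂)
    paired′ c c∈ with paired c (there (∈-insert-middle L₁ c∈))
    ... | d , here refl , Rca = ⊥₀-elim (∉-Unique-middle L₁ uL
            (subst (_∈ L₁ ++ L₂) (R-functional (R-sym Rca) Rab) c∈))
    ... | d , there d∈ , Rcd = d , ∈-remove-middle L₁ d∈ d≢b , Rcd
      where
      d≢b : ¬ d ≡ b
      d≢b refl = Allₚ.All¬⇒¬Any a≢L (subst (_∈ L₁ ++ b ∷ L₂) (R-functional (R-sym Rcd) (R-sym Rab))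
                   (∈-insert-middle L₁ c∈))

  Σs-cancels : ∀ L → Unique L → PairedWithin L → Σs L ≡ pos 0
  Σs-cancels L = Σs-cancels-bounded (length L) L ℕ.≤-refl

-- Iterated coproducts

module _ {E : Set} (ΔT ΔS : E → Maybe (E × E)) where

  coassocL⁻ : ∀ {x a b w} → coassocL ΔT ΔS x ≡ just (a , b , w) →
    Σ E λ u → ΔT x ≡ just (u , w) × ΔS u ≡ just (a , b)
  coassocL⁻ {x} eq with ΔT x in e₁
  ... | just (u , w) with ΔS u in e₂
  ... | just (a , b) with refl ← eq = u , refl , e₂

  coassocL⁺ : ∀ {x u w a b} → ΔT x ≡ just (u , w) → ΔS u ≡ just (a , b) →
    coassocL ΔT ΔS x ≡ just (a , b , w)
  coassocL⁺ e₁ e₂ rewrite e₁ | e₂ = refl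

  coassocR⁻ : ∀ {x a b w} → coassocR ΔT ΔS x ≡ just (a , b , w) →
    Σ E λ v → ΔT x ≡ just (a , v) × ΔS v ≡ just (b , w)
  coassocR⁻ {x} eq with ΔT x in e₁
  ... | just (a , v) with ΔS v in e₂
  ... | just (b , w) with refl ← eq = v , refl , e₂

  coassocR⁺ : ∀ {x v a b w} → ΔT x ≡ just (a , v) → ΔS v ≡ just (b , w) →
    coassocR ΔT ΔS x ≡ just (a , b , w)
  coassocR⁺ e₁ e₂ rewrite e₁ | e₂ = refl

just-injective : ∀ {a} {A : Set a} {u v : A} → just u ≡ just v → u ≡ v
just-injective refl = refl

module IteratedCoproduct {n : ℕ} (H : LinHopf n) where
  open LinHopf H

  Supports : List (Subset n) → List E → Set
  Supports = Pointwise (λ S e → supp e ≡ S)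

  Δs-∷⁻ : ∀ {S A x es} → Δs H (S ∷ A) x ≡ just es →
    Σ E λ a → Σ E λ r → Σ (List E) λ as →
      Δ S x ≡ just (a , r) × Δs H A r ≡ just as × es ≡ a ∷ as
  Δs-∷⁻ {S} {A} {x} eq with Δ S x in e₁
  ... | just (a , r) with Δs H A r in e₂
  ... | just as with refl ← eq = a , r , as , refl , e₂ , refl

  Δs-∷⁺ : ∀ {S A x a r as} → Δ S x ≡ just (a , r) → Δs H A r ≡ just as → Δs H (S ∷ A) x ≡ just (a ∷ as)
  Δs-∷⁺ e₁ e₂ rewrite e₁ | e₂ = refl

  length-Δs : ∀ {F x es} → Δs H F x ≡ just es → length es ≡ length F
  length-Δs {[]}    refl = refl
  length-Δs {S ∷ F} eq with Δs-∷⁻ {S} {F} eq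
  ... | _ , _ , _ , _ , e₂ , refl = cong suc (length-Δs {F} e₂)

  supp-Δ-disjoint : ∀ {S R x a r} → Δ S x ≡ just (a , r) → supp x ≡ S ∪ R → Disjoint S R →
    supp a ≡ S × supp r ≡ R
  supp-Δ-disjoint {S} {R} {x} {a} {r} e sx d with supp-Δ S x a r (subst (S ⊆_) (sym sx) (p⊆p∪q R)) e
  ... | sa , sr = sa , trans sr (trans (cong (_─ S) sx) (∪-─-cancelˡ d))

  Δs-supports : ∀ {F x es} → AllPairs Disjoint F → supp x ≡ ⋃ F → Δs H F x ≡ just es → Supports F es
  Δs-supports {[]}    _        _  refl = []
  Δs-supports {S ∷ F} (d ∷ ds) sx eq with Δs-∷⁻ {S} {F} eq
  ... | _ , _ , _ , e₁ , e₂ , refl with supp-Δ-disjoint e₁ sx (Disjoint-⋃⁺ d)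
  ... | sa , sr = sa ∷ Δs-supports ds sr e₂

  Δ-μ : ∀ {S a b} → supp a ≡ S → Disjoint S (supp b) → Δ S (μ a b) ≡ just (a , b)
  Δ-μ {S} {a} {b} refl d = begin
    Δ S (μ a b)
      ≡⟨ compat S a b d (p⊆p∪q (supp b)) ⟩
    compatR μ (Δ (S ∩ S) a) (Δ (S ∩ supp b) b)
      ≡⟨ cong₂ (λ T U → compatR μ (Δ T a) (Δ U b)) (∩-idem S) d ⟩
    compatR μ (Δ S a) (Δ ⊥ b)
      ≡⟨ cong₂ (compatR μ) (Δ-counitʳ a) (Δ-counitˡ b) ⟩
    just (μ a one , μ one b)
      ≡⟨ cong₂ (λ u v → just (u , v)) (μ-unitʳ a) (μ-unitˡ b) ⟩
    just (a , b) ∎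
    where open ≡-Reasoning

  supp-μs : ∀ {F es} → Supports F es → AllPairs Disjoint F → supp (μs H es) ≡ ⋃ F
  supp-μs []                     []       = supp-one
  supp-μs {S ∷ F} {e ∷ es} (refl ∷ ss) (d ∷ ds) =
    trans (supp-μ e (μs H es) (subst (Disjoint S) (sym (supp-μs ss ds)) (Disjoint-⋃⁺ d)))
          (cong (S ∪_) (supp-μs ss ds))

  Δs-μs : ∀ {F es} → Supports F es → AllPairs Disjoint F → Δs H F (μs H es) ≡ just es
  Δs-μs []                     []       = refl
  Δs-μs {S ∷ F} (se ∷ ss) (d ∷ ds) =
    Δs-∷⁺ {A = F} (Δ-μ se (subst (Disjoint S) (sym (supp-μs ss ds)) (Disjoint-⋃⁺ d))) (Δs-μs ss ds)

  μs-++ : ∀ {F₁ F₂ es₁ es₂} → Supports F₁ es₁ → Supports F₂ es₂ → AllPairs Disjoint (F₁ ++ F₂) →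
    μs H (es₁ ++ es₂) ≡ μ (μs H es₁) (μs H es₂)
  μs-++ [] _ _ = sym (μ-unitˡ _)
  μs-++ {S ∷ F₁} {F₂} {e ∷ es₁} {es₂} (refl ∷ ss₁) ss₂ (d ∷ ds) =
    trans (cong (μ e) (μs-++ ss₁ ss₂ ds))
      (sym (μ-assoc e (μs H es₁) (μs H es₂)
        (subst (Disjoint S) (sym (supp-μs ss₁ ds₁)) (Disjoint-⋃⁺ (Allₚ.++⁻ˡ F₁ d)))
        (subst (Disjoint S) (sym (supp-μs ss₂ ds₂)) (Disjoint-⋃⁺ (Allₚ.++⁻ʳ F₁ d)))
        (subst₂ Disjoint (sym (supp-μs ss₁ ds₁)) (sym (supp-μs ss₂ ds₂)) (Disjoint-⋃-++ F₁ ds))))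
    where
    ds₁ : AllPairs Disjoint F₁
    ds₁ = AllPairs-++⁻ˡ F₁ ds
    ds₂ : AllPairs Disjoint F₂
    ds₂ = AllPairs-++⁻ʳ F₁ ds

  private
    ⋃-∷-++ : ∀ (S : Subset n) g R → ⋃ ((S ∷ g) ++ R) ≡ (S ∪ ⋃ g) ∪ ⋃ R
    ⋃-∷-++ S g R = trans (cong (S ∪_) (⋃-++ g R)) (sym (∪-assoc S (⋃ g) (⋃ R)))

    Δ-coassoc-∷ : ∀ S g R {x} → supp x ≡ ⋃ ((S ∷ g) ++ R) →
      coassocL (Δ (S ∪ ⋃ g)) (Δ S) x ≡ coassocR (Δ S) (Δ ((S ∪ ⋃ g) ─ S)) x
    Δ-coassoc-∷ S g R {x} sx = Δ-coassoc S (S ∪ ⋃ g) x (p⊆p∪q (⋃ g))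
      (subst ((S ∪ ⋃ g) ⊆_) (sym (trans sx (⋃-∷-++ S g R))) (p⊆p∪q (⋃ R)))

  Δs-++⁻ : ∀ g R {x es} → AllPairs Disjoint (g ++ R) → supp x ≡ ⋃ (g ++ R) →
    Δs H (g ++ R) x ≡ just es →
    Σ E λ u → Σ E λ w → Σ (List E) λ us → Σ (List E) λ ws →
      Δ (⋃ g) x ≡ just (u , w) × Δs H g u ≡ just us × Δs H R w ≡ just ws × es ≡ us ++ ws
  Δs-++⁻ [] R {x} {es} _ _ e = one , x , [] , es , Δ-counitˡ x , refl , e , refl
  Δs-++⁻ (S ∷ g) R {x} (d ∷ ds) sx e with Δs-∷⁻ {S} {g ++ R} e
  ... | a , v , _ , e₁ , e₂ , refl with Δs-++⁻ g R ds (proj₂ (supp-Δ-disjoint e₁ sx (Disjoint-⋃⁺ d))) e₂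
  ... | b , w , us , ws , f₁ , f₂ , f₃ , refl
    with coassocL⁻ (Δ (S ∪ ⋃ g)) (Δ S)
           (trans (Δ-coassoc-∷ S g R sx)
             (coassocR⁺ (Δ S) (Δ ((S ∪ ⋃ g) ─ S)) e₁
               (trans (cong (λ T → Δ T v) (∪-─-cancelˡ (Disjoint-⋃⁺ (Allₚ.++⁻ˡ g d)))) f₁)))
  ... | u , h₁ , h₂ = u , w , a ∷ us , ws , h₁ , Δs-∷⁺ {A = g} h₂ f₂ , f₃ , refl

  supp-Δ-⋃-++ : ∀ g R {x u w} → AllPairs Disjoint (g ++ R) → supp x ≡ ⋃ (g ++ R) →
    Δ (⋃ g) x ≡ just (u , w) → supp u ≡ ⋃ g × supp w ≡ ⋃ R
  supp-Δ-⋃-++ g R ds sx e = supp-Δ-disjoint e (trans sx (⋃-++ g R)) (Disjoint-⋃-++ g ds)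

  data BlockCoproducts : List (List (Subset n)) → List E → List (List E) → Set where
    []  : BlockCoproducts [] [] []
    _∷_ : ∀ {g z cs Gs zs css} → Δs H g z ≡ just cs → BlockCoproducts Gs zs css →
          BlockCoproducts (g ∷ Gs) (z ∷ zs) (cs ∷ css)

  Δs-concat⁻ : ∀ Gs {x es} → AllPairs Disjoint (concat Gs) → supp x ≡ ⋃ (concat Gs) →
    Δs H (concat Gs) x ≡ just es →
    Σ (List E) λ zs → Σ (List (List E)) λ css →
      Δs H (map ⋃ Gs) x ≡ just zs × BlockCoproducts Gs zs css × es ≡ concat css
  Δs-concat⁻ []       _  _  refl = [] , [] , refl , [] , refl
  Δs-concat⁻ (g ∷ Gs) ds sx e with Δs-++⁻ g (concat Gs) ds sx e
  ... | u , w , us , _ , e₁ , e₂ , e₃ , refl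
    with Δs-concat⁻ Gs (AllPairs-++⁻ʳ g ds) (proj₂ (supp-Δ-⋃-++ g (concat Gs) ds sx e₁)) e₃
  ... | zs , css , f₁ , f₂ , refl = u ∷ zs , us ∷ css , Δs-∷⁺ {A = map ⋃ Gs} e₁ f₁ , e₂ ∷ f₂ , refl

  private
    blocks₃ : List (Subset n) → Subset n → List (Subset n) → List (List (Subset n))
    blocks₃ P S Q = P ∷ (S ∷ []) ∷ Q ∷ []

    concat-blocks₃ : ∀ P S Q → concat (blocks₃ P S Q) ≡ P ++ S ∷ Q
    concat-blocks₃ P S Q = cong (λ R → P ++ S ∷ R) (List.++-identityʳ Q)

    blocks₃-disjoint : ∀ P S Q → AllPairs Disjoint (P ++ S ∷ Q) → AllPairs Disjoint (concat (blocks₃ P S Q))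
    blocks₃-disjoint P S Q = subst (AllPairs Disjoint) (sym (concat-blocks₃ P S Q))

    supp-blocks₃ : ∀ P S Q {x} → supp x ≡ ⋃ (P ++ S ∷ Q) → supp x ≡ ⋃ (concat (blocks₃ P S Q))
    supp-blocks₃ P S Q sx = trans sx (cong ⋃ (sym (concat-blocks₃ P S Q)))

  Δs-singleton : ∀ {S z} → supp z ≡ S → Δs H (S ∷ []) z ≡ just (z ∷ [])
  Δs-singleton {z = z} refl = Δs-∷⁺ {A = []} (Δ-counitʳ z) refl

  Δs-singleton⁻ : ∀ {S z es} → supp z ≡ S → Δs H (S ∷ []) z ≡ just es → es ≡ z ∷ []
  Δs-singleton⁻ sz e = just-injective (trans (sym e) (Δs-singleton sz))

  Δs-middle : ∀ P S Q {x es₁ e es₂} → AllPairs Disjoint (P ++ S ∷ Q) → supp x ≡ ⋃ (P ++ S ∷ Q) →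
    Δs H (P ++ S ∷ Q) x ≡ just (es₁ ++ e ∷ es₂) → length es₁ ≡ length P →
    Σ E λ p → Σ E λ q → Δs H (⋃ P ∷ S ∷ ⋃ Q ∷ []) x ≡ just (p ∷ e ∷ q ∷ [])
  Δs-middle P S Q {x} {es₁} ds sx ex len
    with Δs-concat⁻ (blocks₃ P S Q) (blocks₃-disjoint P S Q ds) (supp-blocks₃ P S Q sx)
           (subst (λ F → Δs H F x ≡ just _) (sym (concat-blocks₃ P S Q)) ex)
  ... | p ∷ z ∷ q ∷ [] , _ , ez , _∷_ {cs = cs₁} c₁ (c₂ ∷ _ ∷ []) , eq
    with _ ∷ sz ∷ _ ∷ [] ← Δs-supports (AllPairs-Disjoint-map⋃ (blocks₃ P S Q) (blocks₃-disjoint P S Q ds))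
                             (trans (supp-blocks₃ P S Q sx) (sym (⋃-map⋃ (blocks₃ P S Q)))) ez
    with refl ← Δs-singleton⁻ (trans sz (∪-identityʳ S)) c₂
    with refl , e′ ← ++-injective-length es₁ cs₁ (trans len (sym (length-Δs {P} c₁))) eq
    with refl , _ ← List.∷-injective e′
    = p , q , subst (λ T → Δs H (⋃ P ∷ T ∷ ⋃ Q ∷ []) x ≡ _) (∪-identityʳ S) ez

  private
    ∪⊆supp : ∀ {S T Q x} → supp x ≡ ⋃ (S ∷ T ∷ Q) → S ∪ T ⊆ supp x
    ∪⊆supp {S} {T} {Q} sx = subst (S ∪ T ⊆_) (sym (trans sx (sym (∪-assoc S T (⋃ Q))))) (p⊆p∪q (⋃ Q))

  Δs-refine : ∀ P S T Q {x es₁ z es₂ u w} → AllPairs Disjoint (P ++ S ∷ T ∷ Q) →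
    supp x ≡ ⋃ (P ++ S ∷ T ∷ Q) → Δs H (P ++ (S ∪ T) ∷ Q) x ≡ just (es₁ ++ z ∷ es₂) →
    length es₁ ≡ length P → Δ S z ≡ just (u , w) → Δs H (P ++ S ∷ T ∷ Q) x ≡ just (es₁ ++ u ∷ w ∷ es₂)
  Δs-refine [] S T Q {x} {[]} ((d ∷ _) ∷ _) sx ex _ ez with Δs-∷⁻ {S ∪ T} {Q} ex
  ... | _ , r , _ , e₁ , e₂ , refl
    with v , h₁ , h₂ ← coassocR⁻ (Δ S) (Δ ((S ∪ T) ─ S))
                         (trans (sym (Δ-coassoc S (S ∪ T) x (p⊆p∪q T) (∪⊆supp {Q = Q} sx)))
                                (coassocL⁺ (Δ (S ∪ T)) (Δ S) e₁ ez))
    = Δs-∷⁺ {A = T ∷ Q} h₁ (Δs-∷⁺ {A = Q} (subst (λ U → Δ U v ≡ _) (∪-─-cancelˡ d) h₂) e₂)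
  Δs-refine (S₀ ∷ P) S T Q {x} {_ ∷ es₁} (d ∷ ds) sx ex len ez with Δs-∷⁻ {S₀} {P ++ (S ∪ T) ∷ Q} ex
  ... | _ , r , _ , e₁ , e₂ , refl =
    Δs-∷⁺ {A = P ++ S ∷ T ∷ Q} e₁
      (Δs-refine P S T Q ds (proj₂ (supp-Δ-disjoint e₁ sx (Disjoint-⋃⁺ d))) e₂ (ℕ.suc-injective len) ez)

  Supports-concat : ∀ {Gs zs css} → BlockCoproducts Gs zs css → AllPairs Disjoint (concat Gs) →
    Supports (map ⋃ Gs) zs → Supports (concat Gs) (concat css)
  Supports-concat []                 _  []        = []
  Supports-concat {g ∷ Gs} (c ∷ cs) ds (sz ∷ szs) =
    Pointwise.++⁺ (Δs-supports (AllPairs-++⁻ˡ g ds) sz c) (Supports-concat cs (AllPairs-++⁻ʳ g ds) szs)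

  Supports-map-μs : ∀ {Gs zs css} → BlockCoproducts Gs zs css → AllPairs Disjoint (concat Gs) →
    Supports (map ⋃ Gs) zs → Supports (map ⋃ Gs) (map (μs H) css)
  Supports-map-μs []                 _  []        = []
  Supports-map-μs {g ∷ Gs} (c ∷ cs) ds (sz ∷ szs) =
    supp-μs (Δs-supports (AllPairs-++⁻ˡ g ds) sz c) (AllPairs-++⁻ˡ g ds) ∷ Supports-map-μs cs (AllPairs-++⁻ʳ g ds) szs

  μs-concat : ∀ {Gs zs css} → BlockCoproducts Gs zs css → AllPairs Disjoint (concat Gs) →
    Supports (map ⋃ Gs) zs → μs H (concat css) ≡ μs H (map (μs H) css)
  μs-concat []                           _  []        = refl
  μs-concat {g ∷ Gs} {css = cs₀ ∷ _} (c ∷ cs) ds (sz ∷ szs) =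
    trans (μs-++ (Δs-supports (AllPairs-++⁻ˡ g ds) sz c) (Supports-concat cs (AllPairs-++⁻ʳ g ds) szs) ds)
          (cong (μ (μs H cs₀)) (μs-concat cs (AllPairs-++⁻ʳ g ds) szs))

  μs-++-halves : ∀ g₁ g₂ {u w us ws} → AllPairs Disjoint (g₁ ++ g₂) → supp (μs H (us ++ ws)) ≡ ⋃ (g₁ ++ g₂) →
    Δ (⋃ g₁) (μs H (us ++ ws)) ≡ just (u , w) → Δs H g₁ u ≡ just us → Δs H g₂ w ≡ just ws →
    u ≡ μs H us × w ≡ μs H ws
  μs-++-halves g₁ g₂ {u} {w} {us} {ws} ds sz h₁ h₂ h₃ = cong proj₁ halves , cong proj₂ halves
    where
    open ≡-Reasoning
    d₁ : AllPairs Disjoint g₁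
    d₁ = AllPairs-++⁻ˡ g₁ ds
    d₂ : AllPairs Disjoint g₂
    d₂ = AllPairs-++⁻ʳ g₁ ds
    ss₁ : Supports g₁ us
    ss₁ = Δs-supports d₁ (proj₁ (supp-Δ-⋃-++ g₁ g₂ ds sz h₁)) h₂
    ss₂ : Supports g₂ ws
    ss₂ = Δs-supports d₂ (proj₂ (supp-Δ-⋃-++ g₁ g₂ ds sz h₁)) h₃
    d₁₂ : Disjoint (⋃ g₁) (supp (μs H ws))
    d₁₂ = subst (Disjoint (⋃ g₁)) (sym (supp-μs ss₂ d₂)) (Disjoint-⋃-++ g₁ ds)
    halves : (u , w) ≡ (μs H us , μs H ws)
    halves = just-injective (begin
      just (u , w)                        ≡⟨ h₁ ⟨
      Δ (⋃ g₁) (μs H (us ++ ws))          ≡⟨ cong (Δ (⋃ g₁)) (μs-++ ss₁ ss₂ ds) ⟩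
      Δ (⋃ g₁) (μ (μs H us) (μs H ws))    ≡⟨ Δ-μ (supp-μs ss₁ d₁) d₁₂ ⟩
      just (μs H us , μs H ws)            ∎)

  μs-injective : ∀ {F es es′} → Supports F es → Supports F es′ → AllPairs Disjoint F →
    μs H es ≡ μs H es′ → es ≡ es′
  μs-injective {F} ses ses′ ds e =
    just-injective (trans (sym (Δs-μs ses ds)) (trans (cong (Δs H F) e) (Δs-μs ses′ ds)))

-- Restrictions of a linear order

filterₛ : Subset k → List (Fin k) → List (Fin k)
filterₛ S = filter (_∈? S)

module _ {S : Subset k} where

  filterₛ-++-∈∉ : ∀ {u v} → All (_∈ₛ S) u → All (_∉ₛ S) v → filterₛ S (u ++ v) ≡ u
  filterₛ-++-∈∉ {u} {v} u∈ v∉ = begin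
    filterₛ S (u ++ v)            ≡⟨ List.filter-++ (_∈? S) u v ⟩
    filterₛ S u ++ filterₛ S v    ≡⟨ cong₂ _++_ (List.filter-all (_∈? S) u∈) (List.filter-none (_∈? S) v∉) ⟩
    u ++ []                       ≡⟨ List.++-identityʳ u ⟩
    u                             ∎
    where open ≡-Reasoning

  filterₛ-++-∉∈ : ∀ {u v} → All (_∉ₛ S) u → All (_∈ₛ S) v → filterₛ S (u ++ v) ≡ v
  filterₛ-++-∉∈ {u} {v} u∉ v∈ =
    trans (List.filter-++ (_∈? S) u v) (cong₂ _++_ (List.filter-none (_∈? S) u∉) (List.filter-all (_∈? S) v∈))

  filterₛ-⊆-absorb : ∀ {T} xs → S ⊆ T → filterₛ S (filterₛ T xs) ≡ filterₛ S xs
  filterₛ-⊆-absorb {T} [] S⊆T = refl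
  filterₛ-⊆-absorb {T} (i ∷ xs) S⊆T with i ∈? T
  ... | yes _ with i ∈? S
  ...   | yes _ = cong (i ∷_) (filterₛ-⊆-absorb xs S⊆T)
  ...   | no _  = filterₛ-⊆-absorb xs S⊆T
  filterₛ-⊆-absorb {T} (i ∷ xs) S⊆T | no i∉T with i ∈? S
  ...   | yes i∈S = ⊥₀-elim (i∉T (S⊆T i∈S))
  ...   | no _    = filterₛ-⊆-absorb xs S⊆T

All-∈⇒All-∉ : {S T : Subset k} {l : List (Fin k)} → Disjoint S T → All (_∈ₛ T) l → All (_∉ₛ S) l
All-∈⇒All-∉ d = All.map (λ i∈T i∈S → Disjoint⇒∉ d i∈S i∈T)

filterₛ-∪-split : ∀ {S T : Subset k} xs {l₁ l₂} → Disjoint S T → filterₛ (S ∪ T) xs ≡ l₁ ++ l₂ →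
  All (_∈ₛ S) l₁ → All (_∈ₛ T) l₂ → filterₛ S xs ≡ l₁ × filterₛ T xs ≡ l₂
filterₛ-∪-split {S = S} {T} xs {l₁} {l₂} d e l₁∈ l₂∈ =
  (begin
    filterₛ S xs                   ≡⟨ filterₛ-⊆-absorb xs (p⊆p∪q T) ⟨
    filterₛ S (filterₛ (S ∪ T) xs) ≡⟨ cong (filterₛ S) e ⟩
    filterₛ S (l₁ ++ l₂)           ≡⟨ filterₛ-++-∈∉ l₁∈ (All-∈⇒All-∉ d l₂∈) ⟩
    l₁                             ∎) ,
  (begin
    filterₛ T xs                   ≡⟨ filterₛ-⊆-absorb xs (q⊆p∪q S T) ⟨
    filterₛ T (filterₛ (S ∪ T) xs) ≡⟨ cong (filterₛ T) e ⟩
    filterₛ T (l₁ ++ l₂)           ≡⟨ filterₛ-++-∉∈ (All-∈⇒All-∉ (Disjoint-sym d) l₁∈) l₂∈ ⟩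
    l₂                             ∎)
  where open ≡-Reasoning

++-split-by : ∀ (S : Subset k) {u v R R′} → u ++ R ≡ v ++ R′ →
  All (_∈ₛ S) u → All (_∈ₛ S) v → All (_∉ₛ S) R → All (_∉ₛ S) R′ → u ≡ v × R ≡ R′
++-split-by S {u} {v} {R} {R′} e u∈ v∈ R∉ R′∉ with refl ←
    trans (sym (filterₛ-++-∈∉ u∈ R∉)) (trans (cong (filterₛ S) e) (filterₛ-++-∈∉ v∈ R′∉))
  = refl , List.++-cancelˡ u R R′ e

restrictOrd-⊆ : (α : List (Fin k)) (g : List (Subset k)) → All (_∈ₛ ⋃ g) (restrictOrd α g)
restrictOrd-⊆ α []      = []
restrictOrd-⊆ α (S ∷ g) = Allₚ.++⁺ (All.map (p⊆p∪q (⋃ g)) (Allₚ.all-filter (_∈? S) α))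
                                   (All.map (q⊆p∪q S (⋃ g)) (restrictOrd-⊆ α g))

restrictOrd-++ : (α : List (Fin k)) (g₁ g₂ : List (Subset k)) →
  restrictOrd α (g₁ ++ g₂) ≡ restrictOrd α g₁ ++ restrictOrd α g₂
restrictOrd-++ α = List.concatMap-++ (λ S → filterₛ S α)

OrderCompatible : List (Fin k) → List (Subset k) → Set
OrderCompatible α g = filterₛ (⋃ g) α ≡ restrictOrd α g

OrderCompatible-++⁻ : (α : List (Fin k)) (g₁ g₂ : List (Subset k)) → AllPairs Disjoint (g₁ ++ g₂) →
  OrderCompatible α (g₁ ++ g₂) → OrderCompatible α g₁ × OrderCompatible α g₂
OrderCompatible-++⁻ α g₁ g₂ ds oc = filterₛ-∪-split α (Disjoint-⋃-++ g₁ ds)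
  (trans (cong (λ T → filterₛ T α) (sym (⋃-++ g₁ g₂))) (trans oc (restrictOrd-++ α g₁ g₂)))
  (restrictOrd-⊆ α g₁) (restrictOrd-⊆ α g₂)

restrictOrd-map⋃⇔ : (α : List (Fin k)) (Gs : List (List (Subset k))) → AllPairs Disjoint (concat Gs) →
  restrictOrd α (map ⋃ Gs) ≡ restrictOrd α (concat Gs) ⇔ All (OrderCompatible α) Gs
restrictOrd-map⋃⇔ α []       _  = mk⇔ (λ _ → []) (λ _ → refl)
restrictOrd-map⋃⇔ α (g ∷ Gs) ds = mk⇔ to from
  where
  ih : restrictOrd α (map ⋃ Gs) ≡ restrictOrd α (concat Gs) ⇔ All (OrderCompatible α) Gs
  ih = restrictOrd-map⋃⇔ α Gs (AllPairs-++⁻ʳ g ds)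
  d : Disjoint (⋃ g) (⋃ (concat Gs))
  d = Disjoint-⋃-++ g ds
  to : restrictOrd α (map ⋃ (g ∷ Gs)) ≡ restrictOrd α (concat (g ∷ Gs)) →
       All (OrderCompatible α) (g ∷ Gs)
  to e with e₁ , e₂ ← ++-split-by (⋃ g) (trans e (restrictOrd-++ α g (concat Gs)))
                        (Allₚ.all-filter (_∈? ⋃ g) α) (restrictOrd-⊆ α g)
                        (All-∈⇒All-∉ d (subst (λ T → All (_∈ₛ T) (restrictOrd α (map ⋃ Gs))) (⋃-map⋃ Gs)
                                              (restrictOrd-⊆ α (map ⋃ Gs))))
                        (All-∈⇒All-∉ d (restrictOrd-⊆ α (concat Gs)))
    = e₁ ∷ Equivalence.to ih e₂
  from : All (OrderCompatible α) (g ∷ Gs) →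
         restrictOrd α (map ⋃ (g ∷ Gs)) ≡ restrictOrd α (concat (g ∷ Gs))
  from (e₁ ∷ es) = trans (cong₂ _++_ e₁ (Equivalence.from ih es)) (sym (restrictOrd-++ α g (concat Gs)))

Nonempty-map⋃ : (Gs : List (List (Subset k))) → NonemptyBlocks Gs → All Nonempty (concat Gs) →
  All Nonempty (map ⋃ Gs)
Nonempty-map⋃ []             []        _                  = []
Nonempty-map⋃ ([] ∷ Gs)      (ng ∷ _)  _                  = ⊥₀-elim (ng refl)
Nonempty-map⋃ ((S ∷ g) ∷ Gs) (_ ∷ nGs) ((i , i∈S) ∷ nes) =
  (i , p⊆p∪q (⋃ g) i∈S) ∷ Nonempty-map⋃ Gs nGs (Allₚ.++⁻ʳ g nes)

-- Coarsenings of the minimal composition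

module MinimalComposition {n : ℕ} (H : LinHopf n) (I : Subset n) (α β : List (Fin n))
  (x y : LinHopf.E H) (supp-x≡I : LinHopf.supp H x ≡ I)
  (Λ : List (Subset n)) (Λ∈C : InC H I α x β y Λ) where
  open LinHopf H
  open IteratedCoproduct H

  C : List (Subset n) → Set
  C = InC H I α x β y

  Λ-nonempty : All Nonempty Λ
  Λ-nonempty = proj₁ (proj₁ Λ∈C)

  Λ-disjoint : AllPairs Disjoint Λ
  Λ-disjoint = proj₁ (proj₂ (proj₁ Λ∈C))

  private
    xΛ : List E
    xΛ = proj₁ (proj₂ Λ∈C)

    Δs-Λ : Δs H Λ x ≡ just xΛ
    Δs-Λ = proj₁ (proj₂ (proj₂ Λ∈C))

    restrictOrd-Λ : restrictOrd α Λ ≡ β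
    restrictOrd-Λ = proj₁ (proj₂ (proj₂ (proj₂ Λ∈C)))

    μs-xΛ : μs H xΛ ≡ y
    μs-xΛ = proj₂ (proj₂ (proj₂ (proj₂ Λ∈C)))

    ⋃Λ≡I : ⋃ Λ ≡ I
    ⋃Λ≡I = proj₂ (proj₂ (proj₁ Λ∈C))

  supp-x : supp x ≡ ⋃ Λ
  supp-x = trans supp-x≡I (sym ⋃Λ≡I)

  module _ (Gs : List (List (Subset n))) (concat≡Λ : concat Gs ≡ Λ) where

    grouping-disjoint : AllPairs Disjoint (concat Gs)
    grouping-disjoint = subst (AllPairs Disjoint) (sym concat≡Λ) Λ-disjoint

    map⋃-disjoint : AllPairs Disjoint (map ⋃ Gs)
    map⋃-disjoint = AllPairs-Disjoint-map⋃ Gs grouping-disjoint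

    supp-x-map⋃ : supp x ≡ ⋃ (map ⋃ Gs)
    supp-x-map⋃ = trans supp-x (sym (trans (⋃-map⋃ Gs) (cong ⋃ concat≡Λ)))

    Δs-grouping : Σ (List E) λ zs → Σ (List (List E)) λ css →
      Δs H (map ⋃ Gs) x ≡ just zs × BlockCoproducts Gs zs css × xΛ ≡ concat css
    Δs-grouping = Δs-concat⁻ Gs grouping-disjoint (trans supp-x (cong ⋃ (sym concat≡Λ)))
                    (subst (λ F → Δs H F x ≡ just xΛ) (sym concat≡Λ) Δs-Λ)

  -- By C-merge⇔, this says that merging the parts g of Λ = P ++ g ++ Q into one part gives an
  -- element of C.
  Mergeable : List (Subset n) → List (Subset n) → List (Subset n) → Set
  Mergeable P g Q = Σ E λ p → Σ E λ z → Σ E λ q → Σ (List E) λ cs →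
    Δs H (⋃ P ∷ ⋃ g ∷ ⋃ Q ∷ []) x ≡ just (p ∷ z ∷ q ∷ []) × Δs H g z ≡ just cs × μs H cs ≡ z ×
    OrderCompatible α g

  AllMergeable : List (Subset n) → List (List (Subset n)) → Set
  AllMergeable P []       = ⊤
  AllMergeable P (g ∷ Gs) = Mergeable P g (concat Gs) × AllMergeable (P ++ g) Gs

  Δs-grouping-middle : ∀ Gp g Gq {zp z zq} → concat (Gp ++ g ∷ Gq) ≡ Λ →
    Δs H (map ⋃ (Gp ++ g ∷ Gq)) x ≡ just (zp ++ z ∷ zq) → length zp ≡ length Gp →
    Σ E λ p → Σ E λ q → Δs H (⋃ (concat Gp) ∷ ⋃ g ∷ ⋃ (concat Gq) ∷ []) x ≡ just (p ∷ z ∷ q ∷ [])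
  Δs-grouping-middle Gp g Gq concat≡Λ ez len
    with Δs-middle (map ⋃ Gp) (⋃ g) (map ⋃ Gq)
           (subst (AllPairs Disjoint) map-split (map⋃-disjoint (Gp ++ g ∷ Gq) concat≡Λ))
           (trans (supp-x-map⋃ (Gp ++ g ∷ Gq) concat≡Λ) (cong ⋃ map-split))
           (subst (λ F → Δs H F x ≡ just _) map-split ez)
           (trans len (sym (List.length-map ⋃ Gp)))
    where
    map-split : map ⋃ (Gp ++ g ∷ Gq) ≡ map ⋃ Gp ++ ⋃ g ∷ map ⋃ Gq
    map-split = List.map-++ ⋃ Gp (g ∷ Gq)
  ... | p , q , e₃ = p , q , subst₂ (λ U V → Δs H (U ∷ ⋃ g ∷ V ∷ []) x ≡ _) (⋃-map⋃ Gp) (⋃-map⋃ Gq) e₃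

  AllMergeable⇔blockwise : ∀ Gq Gp {zp zq css} → BlockCoproducts Gq zq css → concat (Gp ++ Gq) ≡ Λ →
    Δs H (map ⋃ (Gp ++ Gq)) x ≡ just (zp ++ zq) → length zp ≡ length Gp →
    AllMergeable (concat Gp) Gq ⇔ (map (μs H) css ≡ zq × All (OrderCompatible α) Gq)
  AllMergeable⇔blockwise [] Gp [] _ _ _ = mk⇔ (λ _ → refl , []) (λ _ → tt)
  AllMergeable⇔blockwise (g ∷ Gq) Gp {zp} (_∷_ {z = z} {cs} {zs = zq} {css = css} c cs*) concat≡Λ ez len
    with Δs-grouping-middle Gp g Gq concat≡Λ ez len
  ... | p , q , e₃ = mk⇔ to from
    where
    Gp′ : List (List (Subset n))
    Gp′ = Gp ++ g ∷ []
    context : concat Gp ++ g ≡ concat Gp′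
    context = trans (cong (concat Gp ++_) (sym (List.++-identityʳ g))) (List.concat-++ Gp (g ∷ []))
    ih : AllMergeable (concat Gp ++ g) Gq ⇔ (map (μs H) css ≡ zq × All (OrderCompatible α) Gq)
    ih = subst (λ P → AllMergeable P Gq ⇔ _) (sym context)
           (AllMergeable⇔blockwise Gq Gp′ cs* (trans (cong concat (List.++-assoc Gp (g ∷ []) Gq)) concat≡Λ)
             (subst₂ (λ A B → Δs H (map ⋃ A) x ≡ just B) (sym (List.++-assoc Gp (g ∷ []) Gq))
                (sym (List.++-assoc zp (z ∷ []) zq)) ez)
             (trans (List.length-++ zp) (trans (cong (_+ 1) len) (sym (List.length-++ Gp)))))
    to : AllMergeable (concat Gp) (g ∷ Gq) → map (μs H) (cs ∷ css) ≡ z ∷ zq × All (OrderCompatible α) (g ∷ Gq)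
    to ((_ , _ , _ , _ , t₃ , tc , μ′ , α′) , rest)
      with refl ← just-injective (trans (sym t₃) e₃)
      with refl ← just-injective (trans (sym tc) c)
      = cong₂ _∷_ μ′ (proj₁ (Equivalence.to ih rest)) , α′ ∷ proj₂ (Equivalence.to ih rest)
    from : map (μs H) (cs ∷ css) ≡ z ∷ zq × All (OrderCompatible α) (g ∷ Gq) → AllMergeable (concat Gp) (g ∷ Gq)
    from (e , α′ ∷ αs) with μ′ , e′ ← List.∷-injective e =
      (p , z , q , cs , e₃ , c , μ′ , α′) , Equivalence.from ih (e′ , αs)

  -- Δ_A(x) is a coarsening of Δ_Λ(x), and μ is injective on tensors with fixed supports, so
  -- both x_A = y and α_A = β split into one condition per block.
  C-grouping⇔ : ∀ Gs → concat Gs ≡ Λ → NonemptyBlocks Gs → C (map ⋃ Gs) ⇔ AllMergeable [] Gs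
  C-grouping⇔ Gs concat≡Λ nGs with Δs-grouping Gs concat≡Λ
  ... | zs , css , ez , cs* , xΛ≡ = mk⇔ to from
    where
    ds : AllPairs Disjoint (concat Gs)
    ds = grouping-disjoint Gs concat≡Λ
    blocks⇔ : AllMergeable [] Gs ⇔ (map (μs H) css ≡ zs × All (OrderCompatible α) Gs)
    blocks⇔ = AllMergeable⇔blockwise Gs [] cs* concat≡Λ ez refl
    order⇔ : restrictOrd α (map ⋃ Gs) ≡ restrictOrd α (concat Gs) ⇔ All (OrderCompatible α) Gs
    order⇔ = restrictOrd-map⋃⇔ α Gs ds
    szs : Supports (map ⋃ Gs) zs
    szs = Δs-supports (map⋃-disjoint Gs concat≡Λ) (supp-x-map⋃ Gs concat≡Λ) ez
    y≡ : y ≡ μs H (map (μs H) css)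
    y≡ = trans (sym μs-xΛ) (trans (cong (μs H) xΛ≡) (μs-concat cs* ds szs))
    restrict≡ : restrictOrd α (concat Gs) ≡ β
    restrict≡ = trans (cong (restrictOrd α) concat≡Λ) restrictOrd-Λ
    to : C (map ⋃ Gs) → AllMergeable [] Gs
    to (_ , as , eas , ρ , μas) with refl ← just-injective (trans (sym ez) eas) =
      Equivalence.from blocks⇔
        (μs-injective (Supports-map-μs cs* ds szs) szs (map⋃-disjoint Gs concat≡Λ) (trans (sym y≡) (sym μas)) ,
         Equivalence.to order⇔ (trans ρ (sym restrict≡)))
    from : AllMergeable [] Gs → C (map ⋃ Gs)
    from am with e , αs ← Equivalence.to blocks⇔ am =
      (Nonempty-map⋃ Gs nGs (subst (All Nonempty) (sym concat≡Λ) Λ-nonempty) ,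
       map⋃-disjoint Gs concat≡Λ , trans (⋃-map⋃ Gs) (trans (cong ⋃ concat≡Λ) ⋃Λ≡I)) ,
      zs , ez , trans (Equivalence.from order⇔ αs) restrict≡ , trans (cong (μs H) (sym e)) (sym y≡)

  private
    blocks₃-concat : ∀ P g Q → P ++ g ++ Q ≡ Λ → concat (P ∷ g ∷ Q ∷ []) ≡ Λ
    blocks₃-concat P g Q e = trans (cong (λ R → P ++ g ++ R) (List.++-identityʳ Q)) e

  Δs-blocks₃ : ∀ P g Q → P ++ g ++ Q ≡ Λ →
    Σ E λ p → Σ E λ z → Σ E λ q → Δs H (⋃ P ∷ ⋃ g ∷ ⋃ Q ∷ []) x ≡ just (p ∷ z ∷ q ∷ [])
  Δs-blocks₃ P g Q e with Δs-grouping (P ∷ g ∷ Q ∷ []) (blocks₃-concat P g Q e)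
  ... | p ∷ z ∷ q ∷ [] , _ , e₃ , _ ∷ _ ∷ _ ∷ [] , _ = p , z , q , e₃

  supp-middle : ∀ P g Q {p z q} → P ++ g ++ Q ≡ Λ →
    Δs H (⋃ P ∷ ⋃ g ∷ ⋃ Q ∷ []) x ≡ just (p ∷ z ∷ q ∷ []) → supp z ≡ ⋃ g
  supp-middle P g Q e e₃
    with _ ∷ sz ∷ _ ← Δs-supports (map⋃-disjoint (P ∷ g ∷ Q ∷ []) (blocks₃-concat P g Q e))
                                  (supp-x-map⋃ (P ∷ g ∷ Q ∷ []) (blocks₃-concat P g Q e)) e₃
    = sz

  Mergeable-singleton : ∀ P S Q → P ++ S ∷ Q ≡ Λ → Mergeable P (S ∷ []) Q
  Mergeable-singleton P S Q e with p , z , q , e₃ ← Δs-blocks₃ P (S ∷ []) Q e =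
    p , z , q , z ∷ [] , e₃ , Δs-singleton (trans (supp-middle P (S ∷ []) Q e e₃) (∪-identityʳ S)) ,
    μ-unitʳ z , trans (cong (λ T → filterₛ T α) (∪-identityʳ S)) (sym (List.++-identityʳ _))

  singletons : List (Subset n) → List (List (Subset n))
  singletons = map (_∷ [])

  private
    map⋃-singletons : ∀ P → map ⋃ (singletons P) ≡ P
    map⋃-singletons []      = refl
    map⋃-singletons (S ∷ P) = cong₂ _∷_ (∪-identityʳ S) (map⋃-singletons P)

    concat-singletons : ∀ P → concat (singletons P) ≡ P
    concat-singletons []      = refl
    concat-singletons (S ∷ P) = cong (S ∷_) (concat-singletons P)

    singletons-nonempty : ∀ P → NonemptyBlocks (singletons P)
    singletons-nonempty []      = []
    singletons-nonempty (S ∷ P) = (λ ()) ∷ singletons-nonempty P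

  AllMergeable-singletons : ∀ R P Gs → P ++ R ++ concat Gs ≡ Λ →
    AllMergeable P (singletons R ++ Gs) ⇔ AllMergeable (P ++ R) Gs
  AllMergeable-singletons []      P Gs _ = subst (λ P′ → AllMergeable P Gs ⇔ AllMergeable P′ Gs)
                                             (sym (List.++-identityʳ P)) (mk⇔ (λ a → a) (λ a → a))
  AllMergeable-singletons (S ∷ R) P Gs e = mk⇔
    (λ (_ , a) → subst (λ P′ → AllMergeable P′ Gs) (List.++-assoc P (S ∷ []) R) (Equivalence.to ih a))
    (λ a → Mergeable-singleton P S (concat (singletons R ++ Gs)) e′ ,
           Equivalence.from ih (subst (λ P′ → AllMergeable P′ Gs) (sym (List.++-assoc P (S ∷ []) R)) a))
    where
    ih : AllMergeable (P ++ S ∷ []) (singletons R ++ Gs) ⇔ AllMergeable ((P ++ S ∷ []) ++ R) Gs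
    ih = AllMergeable-singletons R (P ++ S ∷ []) Gs (trans (List.++-assoc P (S ∷ []) (R ++ concat Gs)) e)
    e′ : P ++ S ∷ concat (singletons R ++ Gs) ≡ Λ
    e′ = trans (cong (λ L → P ++ S ∷ L) (trans (sym (List.concat-++ (singletons R) Gs))
                                               (cong (_++ concat Gs) (concat-singletons R)))) e

  C-merge⇔ : ∀ P g Q → P ++ g ++ Q ≡ Λ → ¬ g ≡ [] → C (P ++ ⋃ g ∷ Q) ⇔ Mergeable P g Q
  C-merge⇔ P g Q e g≢[] = mk⇔
    (λ c → Mergeable-tail (proj₁ (Equivalence.to around-g (Equivalence.to grouping (subst C (sym map⋃-Gs) c)))))
    (λ m → subst C map⋃-Gs (Equivalence.from grouping (Equivalence.from around-g
             (Mergeable-tail⁻ m , singletons-after-g))))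
    where
    Gs : List (List (Subset n))
    Gs = singletons P ++ g ∷ singletons Q
    map⋃-Gs : map ⋃ Gs ≡ P ++ ⋃ g ∷ Q
    map⋃-Gs = trans (List.map-++ ⋃ (singletons P) (g ∷ singletons Q))
                    (cong₂ _++_ (map⋃-singletons P) (cong (⋃ g ∷_) (map⋃-singletons Q)))
    concat-Gs : concat Gs ≡ Λ
    concat-Gs = trans (sym (List.concat-++ (singletons P) (g ∷ singletons Q)))
                  (trans (cong₂ _++_ (concat-singletons P) (cong (g ++_) (concat-singletons Q))) e)
    grouping : C (map ⋃ Gs) ⇔ AllMergeable [] Gs
    grouping = C-grouping⇔ Gs concat-Gs
                 (Allₚ.++⁺ (singletons-nonempty P) (g≢[] ∷ singletons-nonempty Q))
    around-g : AllMergeable [] Gs ⇔ AllMergeable P (g ∷ singletons Q)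
    around-g = AllMergeable-singletons P [] (g ∷ singletons Q)
                 (trans (cong (λ L → P ++ g ++ L) (concat-singletons Q)) e)
    e₀ : (P ++ g) ++ Q ++ concat {A = Subset n} [] ≡ Λ
    e₀ = trans (cong (λ L → (P ++ g) ++ L) (List.++-identityʳ Q)) (trans (List.++-assoc P g Q) e)
    singletons-after-g : AllMergeable (P ++ g) (singletons Q)
    singletons-after-g = subst (AllMergeable (P ++ g)) (List.++-identityʳ (singletons Q))
                           (Equivalence.from (AllMergeable-singletons Q (P ++ g) [] e₀) tt)
    Mergeable-tail : Mergeable P g (concat (singletons Q)) → Mergeable P g Q
    Mergeable-tail = subst (Mergeable P g) (concat-singletons Q)
    Mergeable-tail⁻ : Mergeable P g Q → Mergeable P g (concat (singletons Q))
    Mergeable-tail⁻ = subst (Mergeable P g) (sym (concat-singletons Q))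

  MergeableHalves : List (Subset n) → List (Subset n) → List (Subset n) → List (Subset n) → Set
  MergeableHalves P g₁ g₂ Q = Σ E λ p → Σ E λ u → Σ E λ w → Σ E λ q → Σ (List E) λ us → Σ (List E) λ ws →
    Δs H (⋃ P ∷ ⋃ g₁ ∷ ⋃ g₂ ∷ ⋃ Q ∷ []) x ≡ just (p ∷ u ∷ w ∷ q ∷ []) ×
    (Δs H g₁ u ≡ just us × μs H us ≡ u × OrderCompatible α g₁) ×
    (Δs H g₂ w ≡ just ws × μs H ws ≡ w × OrderCompatible α g₂)

  private
    blocks₄-concat : ∀ P g₁ g₂ Q → P ++ (g₁ ++ g₂) ++ Q ≡ Λ → concat (P ∷ g₁ ∷ g₂ ∷ Q ∷ []) ≡ Λ
    blocks₄-concat P g₁ g₂ Q e = trans (cong (λ R → P ++ g₁ ++ g₂ ++ R) (List.++-identityʳ Q))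
                                   (trans (cong (P ++_) (sym (List.++-assoc g₁ g₂ Q))) e)

    blocks₄-disjoint : ∀ P g₁ g₂ Q → P ++ (g₁ ++ g₂) ++ Q ≡ Λ →
      AllPairs Disjoint (⋃ P ∷ ⋃ g₁ ∷ ⋃ g₂ ∷ ⋃ Q ∷ [])
    blocks₄-disjoint P g₁ g₂ Q e = map⋃-disjoint (P ∷ g₁ ∷ g₂ ∷ Q ∷ []) (blocks₄-concat P g₁ g₂ Q e)

    supp-x-blocks₄ : ∀ P g₁ g₂ Q → P ++ (g₁ ++ g₂) ++ Q ≡ Λ →
      supp x ≡ ⋃ (⋃ P ∷ ⋃ g₁ ∷ ⋃ g₂ ∷ ⋃ Q ∷ [])
    supp-x-blocks₄ P g₁ g₂ Q e = supp-x-map⋃ (P ∷ g₁ ∷ g₂ ∷ Q ∷ []) (blocks₄-concat P g₁ g₂ Q e)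

    middle-disjoint : ∀ P g Q → P ++ g ++ Q ≡ Λ → AllPairs Disjoint g
    middle-disjoint P g Q e = AllPairs-++⁻ˡ g (AllPairs-++⁻ʳ P (subst (AllPairs Disjoint) (sym e) Λ-disjoint))

  Mergeable-++⁻ : ∀ P g₁ g₂ Q → P ++ (g₁ ++ g₂) ++ Q ≡ Λ →
    Mergeable P (g₁ ++ g₂) Q → MergeableHalves P g₁ g₂ Q
  Mergeable-++⁻ P g₁ g₂ Q e (p , _ , q , cs , e₃ , ec , refl , αz)
    with Δs-++⁻ g₁ g₂ (middle-disjoint P (g₁ ++ g₂) Q e) (supp-middle P (g₁ ++ g₂) Q e e₃) ec
  ... | u , w , us , ws , h₁ , h₂ , h₃ , refl
    with refl , refl ← μs-++-halves g₁ g₂ (middle-disjoint P (g₁ ++ g₂) Q e) (supp-middle P (g₁ ++ g₂) Q e e₃)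
                                       h₁ h₂ h₃
    = p , μs H us , μs H ws , q , us , ws , e₄ , (h₂ , refl , proj₁ oc) , (h₃ , refl , proj₂ oc)
    where
    oc : OrderCompatible α g₁ × OrderCompatible α g₂
    oc = OrderCompatible-++⁻ α g₁ g₂ (middle-disjoint P (g₁ ++ g₂) Q e) αz
    e₄ : Δs H (⋃ P ∷ ⋃ g₁ ∷ ⋃ g₂ ∷ ⋃ Q ∷ []) x ≡ just (p ∷ μs H us ∷ μs H ws ∷ q ∷ [])
    e₄ = Δs-refine (⋃ P ∷ []) (⋃ g₁) (⋃ g₂) (⋃ Q ∷ []) {es₁ = p ∷ []}
           (blocks₄-disjoint P g₁ g₂ Q e) (supp-x-blocks₄ P g₁ g₂ Q e)
           (subst (λ T → Δs H (⋃ P ∷ T ∷ ⋃ Q ∷ []) x ≡ _) (⋃-++ g₁ g₂) e₃) refl h₁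

  MergeableHalves⇒left : ∀ P g₁ g₂ Q → P ++ (g₁ ++ g₂) ++ Q ≡ Λ →
    MergeableHalves P g₁ g₂ Q → Mergeable P g₁ (g₂ ++ Q)
  MergeableHalves⇒left P g₁ g₂ Q e (p , u , w , q , us , ws , e₄ , (h₂ , μu , α₁) , _)
    with p′ , q′ , e₃ ← Δs-middle (⋃ P ∷ []) (⋃ g₁) (⋃ g₂ ∷ ⋃ Q ∷ []) {es₁ = p ∷ []}
                          (blocks₄-disjoint P g₁ g₂ Q e) (supp-x-blocks₄ P g₁ g₂ Q e) e₄ refl
    = p′ , u , q′ , us
    , subst₂ (λ U V → Δs H (U ∷ ⋃ g₁ ∷ V ∷ []) x ≡ _) (∪-identityʳ (⋃ P)) ⋃-g₂Q e₃
    , h₂ , μu , α₁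
    where
    ⋃-g₂Q : ⋃ g₂ ∪ (⋃ Q ∪ ⊥) ≡ ⋃ (g₂ ++ Q)
    ⋃-g₂Q = trans (cong (⋃ g₂ ∪_) (∪-identityʳ (⋃ Q))) (sym (⋃-++ g₂ Q))

  MergeableHalves⇒right : ∀ P g₁ g₂ Q → P ++ (g₁ ++ g₂) ++ Q ≡ Λ →
    MergeableHalves P g₁ g₂ Q → Mergeable (P ++ g₁) g₂ Q
  MergeableHalves⇒right P g₁ g₂ Q e (p , u , w , q , us , ws , e₄ , _ , (h₃ , μw , α₂))
    with p′ , q′ , e₃ ← Δs-middle (⋃ P ∷ ⋃ g₁ ∷ []) (⋃ g₂) (⋃ Q ∷ []) {es₁ = p ∷ u ∷ []}
                          (blocks₄-disjoint P g₁ g₂ Q e) (supp-x-blocks₄ P g₁ g₂ Q e) e₄ refl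
    = p′ , w , q′ , ws
    , subst₂ (λ U V → Δs H (U ∷ ⋃ g₂ ∷ V ∷ []) x ≡ _) ⋃-Pg₁ (∪-identityʳ (⋃ Q)) e₃
    , h₃ , μw , α₂
    where
    ⋃-Pg₁ : ⋃ P ∪ (⋃ g₁ ∪ ⊥) ≡ ⋃ (P ++ g₁)
    ⋃-Pg₁ = trans (cong (⋃ P ∪_) (∪-identityʳ (⋃ g₁))) (sym (⋃-++ P g₁))

  Mergeable-++⁻ˡ : ∀ P g₁ g₂ Q → P ++ (g₁ ++ g₂) ++ Q ≡ Λ →
    Mergeable P (g₁ ++ g₂) Q → Mergeable P g₁ (g₂ ++ Q)
  Mergeable-++⁻ˡ P g₁ g₂ Q e m = MergeableHalves⇒left P g₁ g₂ Q e (Mergeable-++⁻ P g₁ g₂ Q e m)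

  Mergeable-++⁻ʳ : ∀ P g₁ g₂ Q → P ++ (g₁ ++ g₂) ++ Q ≡ Λ →
    Mergeable P (g₁ ++ g₂) Q → Mergeable (P ++ g₁) g₂ Q
  Mergeable-++⁻ʳ P g₁ g₂ Q e m = MergeableHalves⇒right P g₁ g₂ Q e (Mergeable-++⁻ P g₁ g₂ Q e m)

  m : ℕ
  m = length Λ

  MergedInC : ℕ → ℕ → Set
  MergedInC a b = C (mergeParts a b Λ)

  mergeParts-interval : (P g Q : List (Subset n)) →
    mergeParts (suc (length P)) (length P + length g) (P ++ g ++ Q) ≡ P ++ ⋃ g ∷ Q
  mergeParts-interval P g Q = cong₂ _++_ (take-length-++ P (g ++ Q))
    (cong₂ _∷_ (cong ⋃ (trans (cong (drop (length P)) take-Pg) (drop-length-++ P g))) drop-Pg)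
    where
    Pg++Q : P ++ g ++ Q ≡ (P ++ g) ++ Q
    Pg++Q = sym (List.++-assoc P g Q)
    take-Pg : take (length P + length g) (P ++ g ++ Q) ≡ P ++ g
    take-Pg = subst₂ (λ j L → take j L ≡ P ++ g) (List.length-++ P) (sym Pg++Q) (take-length-++ (P ++ g) Q)
    drop-Pg : drop (length P + length g) (P ++ g ++ Q) ≡ Q
    drop-Pg = subst₂ (λ j L → drop j L ≡ Q) (List.length-++ P) (sym Pg++Q) (drop-length-++ (P ++ g) Q)

  MergedInC⇔Mergeable : ∀ {a b} P g Q → P ++ g ++ Q ≡ Λ → a ≡ suc (length P) → b ≡ length P + length g →
    ¬ g ≡ [] → MergedInC a b ⇔ Mergeable P g Q
  MergedInC⇔Mergeable P g Q e refl refl g≢[] =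
    subst (λ L → C (mergeParts (suc (length P)) (length P + length g) L) ⇔ Mergeable P g Q) e
      (subst (λ L → C L ⇔ Mergeable P g Q) (sym (mergeParts-interval P g Q)) (C-merge⇔ P g Q e g≢[]))

  Interval : ℕ → ℕ → Set
  Interval a b = Σ (List (Subset n)) λ P → Σ (List (Subset n)) λ g → Σ (List (Subset n)) λ Q →
    P ++ g ++ Q ≡ Λ × a ≡ suc (length P) × b ≡ length P + length g × ¬ g ≡ []

  interval : ∀ a b → 1 ≤ a → a ≤ b → b ≤ m → Interval a b
  interval (suc a′) b _ a≤b b≤m =
    take a′ Λ≤b , drop a′ Λ≤b , drop b Λ , concat≡Λ , cong suc (sym length-P) , sym length-Pg , g≢[]
    where
    Λ≤b : List (Subset n)
    Λ≤b = take b Λ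
    length-Λ≤b : length Λ≤b ≡ b
    length-Λ≤b = length-take-≤ b Λ b≤m
    length-P : length (take a′ Λ≤b) ≡ a′
    length-P = length-take-≤ a′ Λ≤b (ℕ.≤-trans (ℕ.n≤1+n a′) (subst (suc a′ ≤_) (sym length-Λ≤b) a≤b))
    length-Pg : length (take a′ Λ≤b) + length (drop a′ Λ≤b) ≡ b
    length-Pg = trans (sym (List.length-++ (take a′ Λ≤b))) (trans (cong length (List.take++drop≡id a′ Λ≤b)) length-Λ≤b)
    concat≡Λ : take a′ Λ≤b ++ drop a′ Λ≤b ++ drop b Λ ≡ Λ
    concat≡Λ = trans (sym (List.++-assoc (take a′ Λ≤b) _ _))
                 (trans (cong (_++ drop b Λ) (List.take++drop≡id a′ Λ≤b)) (List.take++drop≡id b Λ))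
    g≢[] : ¬ drop a′ Λ≤b ≡ []
    g≢[] g≡[] = ℕ.<-irrefl (trans (sym length-P) (trans (sym (ℕ.+-identityʳ _))
                  (trans (sym (cong (λ g → length (take a′ Λ≤b) + length g) g≡[])) length-Pg))) a≤b

  shrink-left : ∀ {a b} → 1 ≤ a → a < b → b ≤ m → MergedInC a b → MergedInC (suc a) b
  shrink-left {a} {b} 1≤a a<b b≤m in-C with interval a b 1≤a (ℕ.<⇒≤ a<b) b≤m
  ... | P , [] , Q , e , _ , _ , g≢[] = ⊥₀-elim (g≢[] refl)
  ... | P , S ∷ g , Q , e , refl , b≡ , g≢[] =
    Equivalence.from (MergedInC⇔Mergeable (P ++ S ∷ []) g Q e′ (cong suc (sym length-PS)) b≡′ g′≢[])
      (Mergeable-++⁻ʳ P (S ∷ []) g Q e (Equivalence.to (MergedInC⇔Mergeable P (S ∷ g) Q e refl b≡ g≢[]) in-C))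
    where
    length-PS : length (P ++ S ∷ []) ≡ suc (length P)
    length-PS = trans (List.length-++ P) (ℕ.+-comm (length P) 1)
    e′ : (P ++ S ∷ []) ++ g ++ Q ≡ Λ
    e′ = trans (List.++-assoc P (S ∷ []) (g ++ Q)) e
    b≡′ : b ≡ length (P ++ S ∷ []) + length g
    b≡′ = trans b≡ (trans (ℕ.+-suc (length P) (length g)) (cong (_+ length g) (sym length-PS)))
    g′≢[] : ¬ g ≡ []
    g′≢[] refl = ℕ.<-irrefl (sym (trans b≡ (ℕ.+-comm (length P) 1))) a<b

  shrink-right : ∀ {a b} → 1 ≤ a → a ≤ b → suc b ≤ m → MergedInC a (suc b) → MergedInC a b
  shrink-right {a} {b} 1≤a a≤b b<m in-C with interval a (suc b) 1≤a (ℕ.m≤n⇒m≤1+n a≤b) b<m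
  ... | P , g , Q , e , a≡ , b≡ , g≢[] with initLast g
  ...   | [] = ⊥₀-elim (g≢[] refl)
  ...   | g′ ∷ʳ′ S =
    Equivalence.from (MergedInC⇔Mergeable P g′ (S ∷ Q) e′ a≡ b≡′ g′≢[])
      (Mergeable-++⁻ˡ P g′ (S ∷ []) Q e (Equivalence.to (MergedInC⇔Mergeable P (g′ ∷ʳ S) Q e a≡ b≡ g≢[]) in-C))
    where
    e′ : P ++ g′ ++ S ∷ Q ≡ Λ
    e′ = trans (cong (P ++_) (sym (List.++-assoc g′ (S ∷ []) Q))) e
    b≡′ : b ≡ length P + length g′
    b≡′ = ℕ.suc-injective (trans b≡ (trans (cong (length P +_) (trans (List.length-++ g′) (ℕ.+-comm (length g′) 1)))
                                          (ℕ.+-suc (length P) (length g′))))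
    g′≢[] : ¬ g′ ≡ []
    g′≢[] refl = ℕ.<-irrefl refl (subst₂ _≤_ a≡ (trans b≡′ (ℕ.+-identityʳ (length P))) a≤b)

  private
    shrink-left* : ∀ {a c d} → 1 ≤ a → a ≤‴ c → c ≤ d → d ≤ m → MergedInC a d → MergedInC c d
    shrink-left* _   ≤‴-refl           _   _   in-C = in-C
    shrink-left* 1≤a (≤‴-step 1+a≤‴c) c≤d d≤m in-C =
      shrink-left* (s≤s z≤n) 1+a≤‴c c≤d d≤m
        (shrink-left 1≤a (ℕ.≤-trans (ℕ.≤‴⇒≤ 1+a≤‴c) c≤d) d≤m in-C)

    shrink-right* : ∀ {a d b} → 1 ≤ a → a ≤ d → d ≤′ b → b ≤ m → MergedInC a b → MergedInC a d
    shrink-right* _   _   ≤′-refl         _     in-C = in-C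
    shrink-right* 1≤a a≤d (≤′-step d≤′b) 1+b≤m in-C =
      shrink-right* 1≤a a≤d d≤′b (ℕ.≤-trans (ℕ.n≤1+n _) 1+b≤m)
        (shrink-right 1≤a (ℕ.≤-trans a≤d (ℕ.≤′⇒≤ d≤′b)) 1+b≤m in-C)

  MergedInC-subinterval : ∀ {a b c d} → 1 ≤ a → a ≤ c → c ≤ d → d ≤ b → b ≤ m →
    MergedInC a b → MergedInC c d
  MergedInC-subinterval 1≤a a≤c c≤d d≤b b≤m in-C =
    shrink-left* 1≤a (ℕ.≤⇒≤‴ a≤c) c≤d (ℕ.≤-trans d≤b b≤m)
      (shrink-right* 1≤a (ℕ.≤-trans a≤c c≤d) (ℕ.≤⇒≤′ d≤b) b≤m in-C)

  module NoEdgeAcross (r : ℕ) (MergedInC? : ∀ a b → Dec (MergedInC a b))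
    (no-edge-across : ∀ a b → IsEdge C Λ a b → ¬ (a ≤ r × suc r ≤ b)) where

    -- If B_ab ∉ C, then (a, b) is an edge across r: the shorter crossing intervals [a + 1, b] and
    -- [a, b - 1] merge into C by induction, and C is closed under subintervals.
    merge-across-bounded : ∀ fuel a b → b ≤ a + fuel → 1 ≤ a → a ≤ r → r < b → b ≤ m →
      MergedInC a r → MergedInC (suc r) b → MergedInC a b
    merge-across-bounded zero a b b≤a+0 _ a≤r r<b _ _ _ =
      ⊥₀-elim (ℕ.<-irrefl refl (ℕ.<-≤-trans (ℕ.≤-<-trans a≤r r<b) (subst (b ≤_) (ℕ.+-identityʳ a) b≤a+0)))
    merge-across-bounded (suc fuel) a (suc b) 1+b≤ 1≤a a≤r r<1+b 1+b≤m in-ar in-rb with MergedInC? a (suc b)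
    ... | yes in-ab = in-ab
    ... | no ∉C = ⊥₀-elim (no-edge-across a (suc b) edge (a≤r , r<1+b))
      where
      b≤ : b ≤ a + fuel
      b≤ = ℕ.≤-pred (subst (suc b ≤_) (ℕ.+-suc a fuel) 1+b≤)
      in-a+1,b+1 : MergedInC (suc a) (suc b)
      in-a+1,b+1 with a ℕ.≟ r
      ... | yes refl = in-rb
      ... | no a≢r = merge-across-bounded fuel (suc a) (suc b) (s≤s b≤) (s≤s z≤n) a<r r<1+b 1+b≤m
                       (shrink-left 1≤a a<r (ℕ.≤-trans (ℕ.n≤1+n r) (ℕ.≤-trans r<1+b 1+b≤m)) in-ar) in-rb
        where
        a<r : a < r
        a<r = ℕ.≤∧≢⇒< a≤r a≢r
      in-a,b : MergedInC a b
      in-a,b with b ℕ.≟ r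
      ... | yes refl = in-ar
      ... | no b≢r = merge-across-bounded fuel a b b≤ 1≤a a≤r r<b (ℕ.≤-trans (ℕ.n≤1+n b) 1+b≤m)
                       in-ar (shrink-right (s≤s z≤n) r<b 1+b≤m in-rb)
        where
        r<b : r < b
        r<b = ℕ.≤∧≢⇒< (ℕ.≤-pred r<1+b) (≢-sym b≢r)
      edge : IsEdge C Λ a (suc b)
      edge = 1≤a , s≤s (ℕ.≤-trans a≤r (ℕ.≤-pred r<1+b)) , 1+b≤m , ∉C , λ s a<s s<1+b →
        MergedInC-subinterval 1≤a ℕ.≤-refl (ℕ.<⇒≤ a<s) (ℕ.≤-pred s<1+b) (ℕ.≤-trans (ℕ.n≤1+n b) 1+b≤m)
          in-a,b ,
        MergedInC-subinterval (s≤s z≤n) a<s (ℕ.<⇒≤ s<1+b) ℕ.≤-refl 1+b≤m in-a+1,b+1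

    merge-across : ∀ {a b} → 1 ≤ a → a ≤ r → r < b → b ≤ m →
      MergedInC a r → MergedInC (suc r) b → MergedInC a b
    merge-across {a} {b} = merge-across-bounded b a b (ℕ.m≤n+m b a)

    Mergeable-++⁺ : ∀ P g h Q → P ++ g ++ h ++ Q ≡ Λ → ¬ g ≡ [] → ¬ h ≡ [] → length P + length g ≡ r →
      Mergeable P g (h ++ Q) → Mergeable (P ++ g) h Q → Mergeable P (g ++ h) Q
    Mergeable-++⁺ P g h Q e g≢[] h≢[] |Pg|≡r mg mh =
      Equivalence.to (MergedInC⇔Mergeable P (g ++ h) Q e-gh refl b≡ gh≢[])
        (merge-across (s≤s z≤n) a≤r (ℕ.m<m+n r (nonempty⇒1≤length h h≢[])) b≤m
          (Equivalence.from (MergedInC⇔Mergeable P g (h ++ Q) e refl (sym |Pg|≡r) g≢[]) mg)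
          (Equivalence.from (MergedInC⇔Mergeable (P ++ g) h Q e-Pg (cong suc (sym |P++g|≡r))
                               (cong (_+ length h) (sym |P++g|≡r)) h≢[]) mh))
      where
      e-Pg : (P ++ g) ++ h ++ Q ≡ Λ
      e-Pg = trans (List.++-assoc P g (h ++ Q)) e
      e-gh : P ++ (g ++ h) ++ Q ≡ Λ
      e-gh = trans (cong (P ++_) (List.++-assoc g h Q)) e
      |P++g|≡r : length (P ++ g) ≡ r
      |P++g|≡r = trans (List.length-++ P) |Pg|≡r
      b≡ : r + length h ≡ length P + length (g ++ h)
      b≡ = trans (cong (_+ length h) (sym |Pg|≡r))
             (trans (ℕ.+-assoc (length P) (length g) (length h)) (cong (length P +_) (sym (List.length-++ g))))
      gh≢[] : ¬ g ++ h ≡ []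
      gh≢[] gh≡[] = g≢[] (List.++-conicalˡ g h gh≡[])
      a≤r : suc (length P) ≤ r
      a≤r = subst (suc (length P) ≤_) |Pg|≡r
              (subst (_≤ length P + length g) (ℕ.+-comm (length P) 1)
                     (ℕ.+-monoʳ-≤ (length P) (nonempty⇒1≤length g g≢[])))
      b≤m : r + length h ≤ m
      b≤m = subst₂ _≤_ (trans (List.length-++ (P ++ g)) (cong (_+ length h) |P++g|≡r))
              (cong length (trans (List.++-assoc (P ++ g) h Q) e-Pg))
              (List.length-++-≤ˡ ((P ++ g) ++ h))

    open Toggle {Subset n}
    open import Relation.Binary.Definitions using (tri<; tri≈; tri>)

    AllMergeable-toggle : ∀ j P Gs → P ++ concat Gs ≡ Λ → length P + j ≡ r → 1 ≤ j → j < length (concat Gs) →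
      NonemptyBlocks Gs → AllMergeable P Gs → AllMergeable P (toggle j Gs)
    AllMergeable-toggle j P (g ∷ Gs) e |P|+j≡r 1≤j j< (ng ∷ nGs) (mg , mGs) with ℕ.<-cmp j (length g)
    ... | tri< _ _ _ = Mergeable-++⁻ˡ P g₁ g₂ (concat Gs) e′ mg′ , Mergeable-++⁻ʳ P g₁ g₂ (concat Gs) e′ mg′ ,
                       subst (λ P′ → AllMergeable P′ Gs) P++g≡ mGs
      where
      g₁ g₂ : List (Subset n)
      g₁ = take j g
      g₂ = drop j g
      e′ : P ++ (g₁ ++ g₂) ++ concat Gs ≡ Λ
      e′ = trans (cong (λ g′ → P ++ g′ ++ concat Gs) (List.take++drop≡id j g)) e
      mg′ : Mergeable P (g₁ ++ g₂) (concat Gs)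
      mg′ = subst (λ g′ → Mergeable P g′ (concat Gs)) (sym (List.take++drop≡id j g)) mg
      P++g≡ : P ++ g ≡ (P ++ g₁) ++ g₂
      P++g≡ = trans (cong (P ++_) (sym (List.take++drop≡id j g))) (sym (List.++-assoc P g₁ g₂))
    ... | tri> _ _ g<j =
      subst (Mergeable P g) (sym (concat-toggle (j ∸ length g) Gs)) mg ,
      AllMergeable-toggle (j ∸ length g) (P ++ g) Gs (trans (List.++-assoc P g (concat Gs)) e) |P++g|+j′≡r
        (ℕ.m<n⇒0<n∸m g<j) (∸-length-< g Gs g<j j<) nGs mGs
      where
      |P++g|+j′≡r : length (P ++ g) + (j ∸ length g) ≡ r
      |P++g|+j′≡r = trans (cong (_+ (j ∸ length g)) (List.length-++ P))
                      (trans (ℕ.+-assoc (length P) (length g) (j ∸ length g))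
                        (trans (cong (length P +_) (ℕ.m+[n∸m]≡n (ℕ.<⇒≤ g<j))) |P|+j≡r))
    AllMergeable-toggle j P (g ∷ []) e _ _ j< _ _ | tri≈ _ j≡g _ = ⊥₀-elim (≮length-last g j≡g j<)
    AllMergeable-toggle j P (g ∷ h ∷ Gs) e |P|+j≡r _ _ (ng ∷ nh ∷ _) (mg , mh , mGs) | tri≈ _ refl _ =
      Mergeable-++⁺ P g h (concat Gs) e ng nh |P|+j≡r mg mh ,
      subst (λ P′ → AllMergeable P′ Gs) (List.++-assoc P g h) mGs

    C-toggle : ∀ Gs → concat Gs ≡ Λ → NonemptyBlocks Gs → 1 ≤ r → r < m →
      C (map ⋃ Gs) → C (map ⋃ (toggle r Gs))
    C-toggle Gs e nGs 1≤r r<m in-C =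
      Equivalence.from (C-grouping⇔ (toggle r Gs) (trans (concat-toggle r Gs) e) (toggle-nonempty r Gs 1≤r r< nGs))
        (AllMergeable-toggle r [] Gs e refl 1≤r r< nGs (Equivalence.to (C-grouping⇔ Gs e nGs) in-C))
      where
      r< : r < length (concat Gs)
      r< = subst (λ L → r < length L) (sym e) r<m

  module TogglePairing (r : ℕ) (1≤r : 1 ≤ r) (r<m : r < m) where
    open Toggle {Subset n}

    TogglePartners : List (Subset n) → List (Subset n) → Set
    TogglePartners A B = Σ (List (List (Subset n))) λ Gs →
      NonemptyBlocks Gs × concat Gs ≡ Λ × A ≡ map ⋃ Gs × B ≡ map ⋃ (toggle r Gs)

    private
      r<concat : ∀ Gs → concat Gs ≡ Λ → r < length (concat Gs)
      r<concat Gs e = subst (λ L → r < length L) (sym e) r<m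

    TogglePartners-sym : ∀ {A B} → TogglePartners A B → TogglePartners B A
    TogglePartners-sym (Gs , nGs , e , refl , refl) =
      toggle r Gs , toggle-nonempty r Gs 1≤r (r<concat Gs e) nGs , trans (concat-toggle r Gs) e , refl ,
      cong (map ⋃) (sym (toggle-involutive r Gs 1≤r (r<concat Gs e) nGs))

    TogglePartners-functional : ∀ {A B B′} → TogglePartners A B → TogglePartners A B′ → B ≡ B′
    TogglePartners-functional (Gs , nGs , e , refl , refl) (Gs′ , nGs′ , e′ , A≡ , refl)
      with refl ← map⋃-injective Gs Gs′ nGs nGs′ (trans e (sym e′)) (grouping-disjoint Gs e)
                    (subst (All Nonempty) (sym e) Λ-nonempty) A≡
      = refl

    length-TogglePartners : ∀ {A B} → TogglePartners A B → length B ≡ suc (length A) ⊎ suc (length B) ≡ length A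
    length-TogglePartners (Gs , _ , e , refl , refl)
      rewrite List.length-map ⋃ (toggle r Gs) | List.length-map ⋃ Gs = length-toggle r Gs (r<concat Gs e)

    TogglePartners-irreflexive : ∀ {A B} → TogglePartners A B → ¬ A ≡ B
    TogglePartners-irreflexive p refl with length-TogglePartners p
    ... | inj₁ e = ℕ.<-irrefl e (ℕ.n<1+n _)
    ... | inj₂ e = ℕ.<-irrefl (sym e) (ℕ.n<1+n _)

    TogglePartners-flips-sign : ∀ {A B} → TogglePartners A B → sgn (length B) ≡ - sgn (length A)
    TogglePartners-flips-sign p with length-TogglePartners p
    ... | inj₁ e = cong sgn e
    ... | inj₂ e = trans (sym (ℤ.neg-involutive _)) (cong (-_ ∘ sgn) e)

    open SignReversingPairing TogglePartners (λ A → sgn (length A)) TogglePartners-sym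
      TogglePartners-functional TogglePartners-irreflexive TogglePartners-flips-sign public

lemma2p9 : (n : ℕ) (H : LinHopf n) (I : Subset n)
    (α β : List (Fin n)) → IsLinOrder I α → IsLinOrder I β →
    (x y : LinHopf.E H) → LinHopf.supp H x ≡ I → LinHopf.supp H y ≡ I →
    (Λ : List (Subset n)) → InC H I α x β y Λ →
    (∀ A → InC H I α x β y A → Refines Λ A) →
    (Σ ℕ λ r → 1 ≤ r × r < length Λ ×
      (∀ a b → IsEdge (InC H I α x β y) Λ a b → ¬ (a ≤ r × suc r ≤ b))) →
    (L : List (List (Subset n))) → Unique L →
    (∀ A → (A ∈ L) ⇔ InC H I α x β y A) →
    signedSum L ≡ pos 0
lemma2p9 n H I α β _ _ x y supp-x≡I _ Λ Λ∈C Λ-minimum (r , 1≤r , r<m , no-edge-across) L L-unique L⇔C =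
  Σs-cancels L L-unique toggle-partner-in-L
  where
  open MinimalComposition H I α β x y supp-x≡I Λ Λ∈C
  open TogglePairing r 1≤r r<m
  open Toggle {Subset n} using (toggle)
  open Equivalence

  C? : ∀ A → Dec (C A)
  C? A = Dec.map (L⇔C A) (A ∈L? L)
    where open import Data.List.Membership.DecPropositional (List.≡-dec (Vec.≡-dec Bool._≟_)) renaming (_∈?_ to _∈L?_)

  open NoEdgeAcross r (λ a b → C? (mergeParts a b Λ)) no-edge-across

  toggle-partner-in-L : PairedWithin L
  toggle-partner-in-L A A∈L with Gs , nGs , concat≡Λ , refl ← Λ-minimum A (to (L⇔C A) A∈L) =
    map ⋃ (toggle r Gs) , from (L⇔C _) (C-toggle Gs concat≡Λ nGs 1≤r r<m (to (L⇔C A) A∈L)) ,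
    (Gs , nGs , concat≡Λ , refl , refl)
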